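{- For every tree $T$ of order $n(T)\ge 4$ with $s(T)$ support vertices, $\gamma_{tR2}(T)\le \frac{3n(T)+2s(T)}{4}$, with equality if and only if $T$ is the corona of a tree.
   Context: A leaf is a vertex of degree one; a support vertex is a vertex adjacent to a leaf. The corona of a graph $H$ is the graph obtained from $H$ by attaching to each vertex of $H$ one new vertex of degree 1. For a graph $G$ and $f:V(G)\to\{0,1,2\}$ let $V_i=\{v:f(v)=i\}$; $f$ is a total Roman $\{2\}$-dominating function (TR2DF) if every vertex $v$ with $f(v)=0$ has a neighbor $u$ with $f(u)=2$ or two distinct neighbors $x,y$ with $f(x)=f(y)=1$, and the subgraph induced by $V_1\cup V_2$ has no isolated vertices. $\gamma_{tR2}(G)$ is the minimum weight $\sum_v f(v)$ of a TR2DF of $G$. -}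

module Defs where

open import Data.Nat using (ℕ; zero; suc; _+_; _*_; _≤_)
open import Data.Bool using (Bool; true; false; if_then_else_)
open import Data.Fin using (Fin; zero; suc)
open import Data.Sum using (_⊎_; inj₁; inj₂)
open import Data.Product using (Σ; ∃; ∃-syntax; _×_; _,_)
open import Data.List using (List; []; _∷_; _++_; [_]; length)
open import Data.List.Relation.Unary.Unique.Propositional using (Unique)
open import Data.List.Relation.Unary.Linked using (Linked)
open import Relation.Binary.PropositionalEquality using (_≡_; _≢_)
open import Relation.Nullary using (¬_)
open import Function.Bundles using (_↔_; Inverse)

record Graph : Set where
  field
    n      : ℕ
    adj    : Fin n → Fin n → Bool
    sym    : ∀ u v → adj u v ≡ adj v u
    irrefl : ∀ v → adj v v ≡ false

open Graph public

E : (G : Graph) → Fin (n G) → Fin (n G) → Set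
E G u v = adj G u v ≡ true

sumFin : (m : ℕ) → (Fin m → ℕ) → ℕ
sumFin zero    f = 0
sumFin (suc m) f = f zero + sumFin m (λ i → f (suc i))

countFin : (m : ℕ) → (Fin m → Bool) → ℕ
countFin m p = sumFin m (λ i → if p i then 1 else 0)

degree : (G : Graph) → Fin (n G) → ℕ
degree G v = countFin (n G) (adj G v)

IsLeaf : (G : Graph) → Fin (n G) → Set
IsLeaf G v = degree G v ≡ 1

isLeafB : (G : Graph) → Fin (n G) → Bool
isLeafB G v with degree G v
... | 1 = true
... | _ = false

anyFin : (m : ℕ) → (Fin m → Bool) → Bool
anyFin zero    p = false
anyFin (suc m) p = if p zero then true else anyFin m (λ i → p (suc i))

isSupportB : (G : Graph) → Fin (n G) → Bool
isSupportB G v = anyFin (n G) (λ u → if adj G v u then isLeafB G u else false)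

supportCount : Graph → ℕ
supportCount G = countFin (n G) (isSupportB G)

data Walk (G : Graph) : Fin (n G) → Fin (n G) → Set where
  here : ∀ {v} → Walk G v v
  step : ∀ {u v w} → E G u v → Walk G v w → Walk G u w

Connected : Graph → Set
Connected G = ∀ u v → Walk G u v

IsCycle : (G : Graph) → List (Fin (n G)) → Set
IsCycle G []       = ¬ (0 ≡ 0)
IsCycle G (x ∷ xs) = (2 ≤ length xs) × Unique (x ∷ xs) × Linked (E G) (x ∷ xs ++ [ x ])

Acyclic : Graph → Set
Acyclic G = ∀ c → ¬ IsCycle G c

IsTree : Graph → Set
IsTree G = Connected G × Acyclic G

-- Corona: vertex set Fin m ⊎ Fin m; inj₁ a are the vertices of H,
-- inj₂ a is the new pendant vertex attached to a.
coronaAdj : (H : Graph) → Fin (n H) ⊎ Fin (n H) → Fin (n H) ⊎ Fin (n H) → Bool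
coronaAdj H (inj₁ a) (inj₁ b) = adj H a b
coronaAdj H (inj₁ a) (inj₂ b) with a Data.Fin.≟ b
... | Relation.Nullary.yes _ = true
... | Relation.Nullary.no _  = false
coronaAdj H (inj₂ a) (inj₁ b) with a Data.Fin.≟ b
... | Relation.Nullary.yes _ = true
... | Relation.Nullary.no _  = false
coronaAdj H (inj₂ a) (inj₂ b) = false

IsCoronaOfTree : Graph → Set
IsCoronaOfTree G =
  Σ Graph λ H → IsTree H ×
    Σ (Fin (n G) ↔ (Fin (n H) ⊎ Fin (n H))) λ φ →
      ∀ x y → adj G x y ≡ coronaAdj H (Inverse.to φ x) (Inverse.to φ y)

IsTR2DF : (G : Graph) → (Fin (n G) → ℕ) → Set
IsTR2DF G f =
  (∀ v → f v ≤ 2) ×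
  (∀ v → f v ≡ 0 →
     (∃[ u ] (E G v u × f u ≡ 2)) ⊎
     (∃[ x ] ∃[ y ] (x ≢ y × E G v x × E G v y × f x ≡ 1 × f y ≡ 1))) ×
  (∀ v → f v ≢ 0 → ∃[ u ] (E G v u × f u ≢ 0))

weight : (G : Graph) → (Fin (n G) → ℕ) → ℕ
weight G f = sumFin (n G) f

IsγtR2 : Graph → ℕ → Set
IsγtR2 G k = (∃[ f ] (IsTR2DF G f × weight G f ≡ k)) ×
             (∀ f → IsTR2DF G f → k ≤ weight G f)

-- Root T at a leaf and colour every vertex by its depth modulo 3. For each colour i
-- there is a TR2DF f i: a non-leaf with ℓ leaf neighbours gets 2 if ℓ ≥ 2, 1 if ℓ = 1,
-- and, if ℓ = 0, 1 unless its colour is i; a leaf gets 1 if it is the only leaf of its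
-- support, or if it is the first leaf of a support on whose non-leaf neighbours f i
-- vanishes. Adjacent vertices have different colours and every non-leaf has neighbours
-- of both other colours, which is what makes each f i a TR2DF.
-- Moving the value of every leaf to its support, f 0 + f 1 + f 2 puts at most 3/4 of the
-- budget 3 + 3ℓ + 2[ℓ > 0] on each non-leaf, with equality only if ℓ = 1. The budgets add
-- up to 3n + 2s, hence 3γ ≤ 3(3n + 2s)/4, and equality forces every non-leaf to carry
-- exactly one leaf: T is the corona of the tree on its non-leaves. Conversely, in a corona
-- every support together with its leaf has weight at least 2 under any TR2DF, so
-- 4γ ≥ 8 · n/2 = 3n + 2s.
module Submission where

open import Defs hiding (sym)
import Algebra.Properties.Semiring.Sum
open import Data.Bool using (Bool; true; false; if_then_else_; _∧_; _∨_; not)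
open import Data.Bool.Properties using (∨-zeroʳ; ∨-conicalˡ; ∧-conicalˡ; ∧-conicalʳ; not-injective)
open import Data.Empty using (⊥-elim)
open import Data.Empty.Irrelevant using () renaming (⊥-elim to ⊥-elim-irr)
open import Data.Fin using (Fin; zero; suc; _≟_; punchIn; fromℕ<)
open import Data.Fin.Patterns using (0F; 1F; 2F)
import Data.Fin.Properties as Finₚ
open Finₚ using (punchInᵢ≢i; +↔⊎; injective⇒≤)
open import Data.List using (List; []; _∷_; _++_; [_]; length; allFin; map)
open import Data.List.Properties using (length-++; length-map; map-++)
open import Data.List.Extrema.Nat using (argmax; f[xs]≤f[argmax])
open import Data.List.Membership.Propositional.Properties using (∈-allFin)
open import Data.List.Relation.Unary.All as All using (All; []; _∷_)
open import Data.List.Relation.Unary.All.Properties using (++⁺)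
open import Data.List.Relation.Unary.AllPairs using ([]; _∷_)
import Data.List.Relation.Unary.AllPairs.Properties as AllPairs
open import Data.List.Relation.Unary.Linked using (Linked; []; [-]; _∷_)
import Data.List.Relation.Unary.Linked.Properties as Linked
open import Data.List.Relation.Unary.Unique.Propositional using (Unique)
import Data.List.Relation.Unary.Unique.Propositional.Properties as Unique
open import Data.Nat using (ℕ; zero; suc; _+_; _*_; _≤_; _<_; z≤n; s≤s) renaming (_≟_ to _≟ℕ_)
open import Data.Nat.Properties
  using ( ≤-refl; ≤-trans; ≤-reflexive; ≤-antisym; ≤-pred; ≤∧≢⇒<; _≤?_; ≰⇒>; <⇒≤; ≤⇒≯; <-cmp
        ; n≤1+n; n≤0⇒n≡0; m≤n+m; 1+n≰n; 1+n≢0; 1+n≢n; suc-injective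
        ; +-comm; +-identityʳ; +-mono-≤; +-mono-<-≤; +-mono-≤-<; +-monoʳ-≤; +-monoˡ-≤
        ; *-assoc; *-identityʳ; *-zeroʳ; *-monoʳ-≤; *-cancelˡ-≤; +-*-semiring; module ≤-Reasoning )
open import Data.Product using (∃-syntax; _×_; _,_; proj₁; proj₂)
open import Data.Sum using (_⊎_; inj₁; inj₂)
open import Function using (_∘_)
open import Function.Bundles using (_⇔_; _↔_; Inverse; Injection; mk⇔; mk↔ₛ′)
open import Function.Properties.Inverse using (↔⇒↣)
open import Function.Construct.Symmetry using (↔-sym)
open import Function.Construct.Composition using (_↔-∘_)
open import Relation.Binary.PropositionalEquality
  using (_≡_; _≢_; refl; sym; trans; cong; cong₂; subst; subst₂; module ≡-Reasoning)
open import Relation.Binary.Definitions using (tri<; tri≈; tri>)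
open import Relation.Nullary using (¬_; Dec; yes; no; does)
open import Relation.Nullary.Decidable using (dec-true; dec-false; does-⇔)

module ∑ = Algebra.Properties.Semiring.Sum +-*-semiring

∧-true : ∀ {a b} → a ∧ b ≡ true → a ≡ true × b ≡ true
∧-true {a} {b} a∧b = ∧-conicalˡ a b a∧b , ∧-conicalʳ a b a∧b

∧-false : ∀ {a b} → a ≡ true → a ∧ b ≡ false → b ≡ false
∧-false refl b≡false = b≡false

∨-introˡ : ∀ {a b} → a ≡ true → a ∨ b ≡ true
∨-introˡ refl = refl

∨-introʳ : ∀ {a b} → b ≡ true → a ∨ b ≡ true
∨-introʳ {a} refl = ∨-zeroʳ a

∨-true-¬ˡ : ∀ {a b} → a ≡ false → a ∨ b ≡ true → b ≡ true
∨-true-¬ˡ refl b≡true = b≡true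

true≢false : true ≢ false
true≢false ()

does-true⇒ : ∀ {A : Set} (a? : Dec A) → does a? ≡ true → A
does-true⇒ (yes a) _ = a

does-false⇒¬ : ∀ {A : Set} (a? : Dec A) → does a? ≡ false → ¬ A
does-false⇒¬ (no ¬a) _ = ¬a

𝟙≡0⇒false : ∀ {b} → (if b then 1 else 0) ≡ 0 → b ≡ false
𝟙≡0⇒false {false} _ = refl

𝟙≤1 : ∀ b → (if b then 1 else 0) ≤ 1
𝟙≤1 true  = ≤-refl
𝟙≤1 false = z≤n

sumFin≡sum : ∀ m (f : Fin m → ℕ) → sumFin m f ≡ ∑.sum f
sumFin≡sum zero    f = refl
sumFin≡sum (suc m) f = cong (f zero +_) (sumFin≡sum m (f ∘ suc))

sumFin-cong : ∀ {m} {f g : Fin m → ℕ} → (∀ i → f i ≡ g i) → sumFin m f ≡ sumFin m g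
sumFin-cong {m} {f} {g} f≗g = begin
  sumFin m f  ≡⟨ sumFin≡sum m f ⟩
  ∑.sum f     ≡⟨ ∑.sum-cong-≗ f≗g ⟩
  ∑.sum g     ≡⟨ sumFin≡sum m g ⟨
  sumFin m g  ∎
  where open ≡-Reasoning

sumFin-+ : ∀ {m} (f g : Fin m → ℕ) → sumFin m (λ i → f i + g i) ≡ sumFin m f + sumFin m g
sumFin-+ {m} f g = begin
  sumFin m (λ i → f i + g i)  ≡⟨ sumFin≡sum m _ ⟩
  ∑.sum (λ i → f i + g i)     ≡⟨ ∑.∑-distrib-+ f g ⟩
  ∑.sum f + ∑.sum g           ≡⟨ cong₂ _+_ (sumFin≡sum m f) (sumFin≡sum m g) ⟨
  sumFin m f + sumFin m g     ∎
  where open ≡-Reasoning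

sumFin-*ˡ : ∀ {m} c (f : Fin m → ℕ) → sumFin m (λ i → c * f i) ≡ c * sumFin m f
sumFin-*ˡ {m} c f = begin
  sumFin m (λ i → c * f i)  ≡⟨ sumFin≡sum m _ ⟩
  ∑.sum (λ i → c * f i)     ≡⟨ ∑.*-distribˡ-sum c f ⟨
  c * ∑.sum f               ≡⟨ cong (c *_) (sumFin≡sum m f) ⟨
  c * sumFin m f            ∎
  where open ≡-Reasoning

sumFin-comm : ∀ {m k} (f : Fin m → Fin k → ℕ) →
  sumFin m (λ i → sumFin k (f i)) ≡ sumFin k (λ j → sumFin m (λ i → f i j))
sumFin-comm {m} {k} f = begin
  sumFin m (λ i → sumFin k (f i))            ≡⟨ sumFin-cong (λ i → sumFin≡sum k (f i)) ⟩
  sumFin m (λ i → ∑.sum (f i))               ≡⟨ sumFin≡sum m _ ⟩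
  ∑.sum (λ i → ∑.sum (f i))                  ≡⟨ ∑.∑-comm f ⟩
  ∑.sum (λ j → ∑.sum (λ i → f i j))          ≡⟨ sumFin≡sum k _ ⟨
  sumFin k (λ j → ∑.sum (λ i → f i j))       ≡⟨ sumFin-cong (λ j → sumFin≡sum m (λ i → f i j)) ⟨
  sumFin k (λ j → sumFin m (λ i → f i j))    ∎
  where open ≡-Reasoning

sumFin-one : ∀ m → sumFin m (λ _ → 1) ≡ m
sumFin-one zero    = refl
sumFin-one (suc m) = cong suc (sumFin-one m)

sumFin-mono : ∀ {m} {f g : Fin m → ℕ} → (∀ i → f i ≤ g i) → sumFin m f ≤ sumFin m g
sumFin-mono {zero}  f≤g = z≤n
sumFin-mono {suc m} f≤g = +-mono-≤ (f≤g zero) (sumFin-mono (f≤g ∘ suc))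

sumFin-mono-< : ∀ {m} {f g : Fin m → ℕ} → (∀ i → f i ≤ g i) → ∀ j → f j < g j → sumFin m f < sumFin m g
sumFin-mono-< {suc m} f≤g zero    fj<gj = +-mono-<-≤ fj<gj (sumFin-mono (f≤g ∘ suc))
sumFin-mono-< {suc m} f≤g (suc j) fj<gj = +-mono-≤-< (f≤g zero) (sumFin-mono-< (f≤g ∘ suc) j fj<gj)

sumFin-zero : ∀ {m} {f : Fin m → ℕ} → (∀ i → f i ≡ 0) → sumFin m f ≡ 0
sumFin-zero {zero}  f≡0 = refl
sumFin-zero {suc m} f≡0 = cong₂ _+_ (f≡0 zero) (sumFin-zero (f≡0 ∘ suc))

sumFin-single : ∀ {m} {f : Fin m → ℕ} j → (∀ i → i ≢ j → f i ≡ 0) → sumFin m f ≡ f j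
sumFin-single {suc m} {f} zero    f≡0 = trans (cong (f zero +_) (sumFin-zero (λ i → f≡0 (suc i) λ ()))) (+-identityʳ _)
sumFin-single {suc m}     (suc j) f≡0 =
  cong₂ _+_ (f≡0 zero λ ()) (sumFin-single j (λ i i≢j → f≡0 (suc i) (i≢j ∘ Finₚ.suc-injective)))

sumFin-if : ∀ {m} (p : Fin m → Bool) c → sumFin m (λ i → if p i then c else 0) ≡ c * countFin m p
sumFin-if {m} p c = trans (sumFin-cong c·𝟙) (sumFin-*ˡ {m} c _)
  where
  c·𝟙 : ∀ i → (if p i then c else 0) ≡ c * (if p i then 1 else 0)
  c·𝟙 i with p i
  ... | true  = sym (*-identityʳ c)
  ... | false = sym (*-zeroʳ c)

count-≥1 : ∀ {m} (p : Fin m → Bool) {i} → p i ≡ true → 1 ≤ countFin m p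
count-≥1 {suc m} p {zero}  pi rewrite pi = s≤s z≤n
count-≥1 {suc m} p {suc i} pi = ≤-trans (count-≥1 (p ∘ suc) pi) (m≤n+m _ _)

count-≥2 : ∀ {m} (p : Fin m → Bool) {i j} → i ≢ j → p i ≡ true → p j ≡ true → 2 ≤ countFin m p
count-≥2 {suc m} p {zero}  {zero}  i≢j _  _  = ⊥-elim (i≢j refl)
count-≥2 {suc m} p {zero}  {suc j} _   pi pj rewrite pi = s≤s (count-≥1 (p ∘ suc) pj)
count-≥2 {suc m} p {suc i} {zero}  _   pi pj rewrite pj = s≤s (count-≥1 (p ∘ suc) pi)
count-≥2 {suc m} p {suc i} {suc j} i≢j pi pj =
  ≤-trans (count-≥2 (p ∘ suc) (i≢j ∘ cong suc) pi pj) (m≤n+m _ _)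

count-witness : ∀ {m} (p : Fin m → Bool) → 1 ≤ countFin m p → ∃[ i ] p i ≡ true
count-witness {suc m} p 1≤c with p zero in p0
... | true  = zero , p0
... | false = let i , pi = count-witness (p ∘ suc) 1≤c in suc i , pi

count-witnesses : ∀ {m} (p : Fin m → Bool) → 2 ≤ countFin m p →
  ∃[ i ] ∃[ j ] i ≢ j × p i ≡ true × p j ≡ true
count-witnesses {suc m} p 2≤c with p zero in p0
... | true  = let j , pj = count-witness (p ∘ suc) (≤-pred 2≤c)
              in zero , suc j , (λ ()) , p0 , pj
... | false = let i , j , i≢j , pi , pj = count-witnesses (p ∘ suc) 2≤c
              in suc i , suc j , i≢j ∘ Finₚ.suc-injective , pi , pj

count≡1⇒unique : ∀ {m} (p : Fin m → Bool) → countFin m p ≡ 1 → ∀ {i j} → p i ≡ true → p j ≡ true → i ≡ j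
count≡1⇒unique p c≡1 {i} {j} pi pj with i ≟ j
... | yes i≡j = i≡j
... | no  i≢j = ⊥-elim (1+n≰n (subst (2 ≤_) c≡1 (count-≥2 p i≢j pi pj)))

count≡0⇒false : ∀ {m} (p : Fin m → Bool) → countFin m p ≡ 0 → ∀ i → p i ≡ false
count≡0⇒false p c≡0 i with p i in pi
... | false = refl
... | true  = ⊥-elim (1+n≰n (subst (1 ≤_) c≡0 (count-≥1 p pi)))

count≡1 : ∀ {m} (p : Fin m → Bool) {j} → p j ≡ true → (∀ i → p i ≡ true → i ≡ j) → countFin m p ≡ 1
count≡1 p {j} pj unique = trans (sumFin-single j off-j) (cong (λ b → if b then 1 else 0) pj)
  where
  off-j : ∀ i → i ≢ j → (if p i then 1 else 0) ≡ 0
  off-j i i≢j with p i in pi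
  ... | true  = ⊥-elim (i≢j (unique i pi))
  ... | false = refl

count≡0 : ∀ {m} (p : Fin m → Bool) → (∀ i → p i ≡ false) → countFin m p ≡ 0
count≡0 p p≡false = sumFin-zero (λ i → cong (λ b → if b then 1 else 0) (p≡false i))

count-mono : ∀ {m} (p q : Fin m → Bool) → (∀ i → p i ≡ true → q i ≡ true) → countFin m p ≤ countFin m q
count-mono p q p⇒q = sumFin-mono 𝟙-mono
  where
  𝟙-mono : ∀ i → (if p i then 1 else 0) ≤ (if q i then 1 else 0)
  𝟙-mono i with p i in pi
  ... | true  rewrite p⇒q i pi = ≤-refl
  ... | false = z≤n

count-∨ : ∀ {m} (p q : Fin m → Bool) → countFin m (λ i → p i ∨ q i) ≤ countFin m p + countFin m q
count-∨ {m} p q = ≤-trans (sumFin-mono 𝟙-∨) (≤-reflexive (sumFin-+ {m} _ _))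
  where
  𝟙-∨ : ∀ i → (if p i ∨ q i then 1 else 0) ≤ (if p i then 1 else 0) + (if q i then 1 else 0)
  𝟙-∨ i with p i
  ... | true  = s≤s z≤n
  ... | false = ≤-refl

count-all : ∀ {m} (p : Fin m → Bool) → (∀ i → p i ≡ true) → countFin m p ≡ m
count-all {m} p p≡true = trans (sumFin-cong (λ i → cong (λ b → if b then 1 else 0) (p≡true i))) (sumFin-one m)

anyFin-witness : ∀ {m} (p : Fin m → Bool) → anyFin m p ≡ true → ∃[ i ] p i ≡ true
anyFin-witness {suc m} p any with p zero in p0
... | true  = zero , p0
... | false = let i , pi = anyFin-witness (p ∘ suc) any in suc i , pi

anyFin-intro : ∀ {m} (p : Fin m → Bool) {i} → p i ≡ true → anyFin m p ≡ true
anyFin-intro {suc m} p {zero}  pi rewrite pi = refl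
anyFin-intro {suc m} p {suc i} pi with p zero
... | true  = refl
... | false = anyFin-intro (p ∘ suc) pi

anyFin-false : ∀ {m} (p : Fin m → Bool) → anyFin m p ≡ false → ∀ i → p i ≡ false
anyFin-false p none i with p i in pi
... | false = refl
... | true  with () ← trans (sym (anyFin-intro p pi)) none

isFirst : ∀ {m} → (Fin m → Bool) → Fin m → Bool
isFirst p zero    = p zero
isFirst p (suc i) = not (p zero) ∧ isFirst (p ∘ suc) i

isFirst⇒true : ∀ {m} (p : Fin m → Bool) {i} → isFirst p i ≡ true → p i ≡ true
isFirst⇒true p {zero}  first = first
isFirst⇒true p {suc i} first with p zero
isFirst⇒true p {suc i} first | false = isFirst⇒true (p ∘ suc) first

isFirst-exists : ∀ {m} (p : Fin m → Bool) {i} → p i ≡ true → ∃[ j ] isFirst p j ≡ true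
isFirst-exists {suc m} p {i} pi with p zero in p0
... | true  = zero , p0
isFirst-exists {suc m} p {zero}  pi | false with () ← trans (sym pi) p0
isFirst-exists {suc m} p {suc i} pi | false =
  let j , first = isFirst-exists (p ∘ suc) pi in suc j , subst (λ b → not b ∧ isFirst (p ∘ suc) j ≡ true) (sym p0) first

count-isFirst≤1 : ∀ {m} (p : Fin m → Bool) → countFin m (isFirst p) ≤ 1
count-isFirst≤1 {zero}  p = z≤n
count-isFirst≤1 {suc m} p with p zero
... | true  = ≤-reflexive (cong suc (count≡0 {m} (λ _ → false) (λ _ → refl)))
... | false = count-isFirst≤1 (p ∘ suc)

least-witness : (p : ℕ → Bool) → ∀ N → p N ≡ true → ∃[ k ] p k ≡ true × (∀ j → j < k → p j ≡ false)
least-witness p zero    pN = zero , pN , λ _ ()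
least-witness p (suc N) pN with p zero in p0
... | true  = zero , p0 , λ _ ()
... | false with least-witness (p ∘ suc) N pN
... | k , pk , below = suc k , pk , λ where
  zero    _         → p0
  (suc j) (s≤s j<k) → below j j<k

exists-other : ∀ {m} → 2 ≤ m → (i : Fin m) → ∃[ j ] j ≢ i
exists-other {suc (suc _)} _ i = punchIn i zero , punchInᵢ≢i i zero
exists-other {suc zero} (s≤s ())

-- Membership proofs are irrelevant, so a position depends on the element only.
record Enumeration {m} (p : Fin m → Bool) : Set where
  field
    size             : ℕ
    element          : Fin size → Fin m
    element-p        : ∀ a → p (element a) ≡ true
    position         : ∀ x → .(p x ≡ true) → Fin size
    element∘position : ∀ x .(px : p x ≡ true) → element (position x px) ≡ x
    position∘element : ∀ a → position (element a) (element-p a) ≡ a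

  position-cong : ∀ {x y} .{px : p x ≡ true} .{py : p y ≡ true} → x ≡ y → position x px ≡ position y py
  position-cong refl = refl

  element-injective : ∀ {a b} → element a ≡ element b → a ≡ b
  element-injective {a} {b} eq = trans (sym (position∘element a)) (trans (position-cong eq) (position∘element b))

enumerate : ∀ {m} (p : Fin m → Bool) → Enumeration p
enumerate {zero} p = record
  { size = 0 ; element = λ () ; element-p = λ () ; position = λ ()
  ; element∘position = λ () ; position∘element = λ () }
enumerate {suc m} p with p zero in p0
... | true = record
  { size             = suc R.size
  ; element          = λ { zero → zero ; (suc a) → suc (R.element a) }
  ; element-p        = λ { zero → p0 ; (suc a) → R.element-p a }
  ; position         = λ { zero _ → zero ; (suc x) px → suc (R.position x px) }
  ; element∘position = λ { zero _ → refl ; (suc x) px → cong suc (R.element∘position x px) }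
  ; position∘element = λ { zero → refl ; (suc a) → cong suc (R.position∘element a) }
  }
  where module R = Enumeration (enumerate (p ∘ suc))
... | false = record
  { size             = R.size
  ; element          = suc ∘ R.element
  ; element-p        = R.element-p
  ; position         = λ { zero p0≡true → ⊥-elim-irr (true≢false (trans (sym p0≡true) p0)) ; (suc x) px → R.position x px }
  ; element∘position = λ { zero p0≡true → ⊥-elim-irr (true≢false (trans (sym p0≡true) p0)) ; (suc x) px → cong suc (R.element∘position x px) }
  ; position∘element = R.position∘element
  }
  where module R = Enumeration (enumerate (p ∘ suc))

next : Fin 3 → Fin 3
next 0F = 1F
next 1F = 2F
next 2F = 0F

next≢ : ∀ c → next c ≢ c
next≢ 0F ()
next≢ 1F ()
next≢ 2F ()

next²≢ : ∀ c → next (next c) ≢ c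
next²≢ 0F ()
next²≢ 1F ()
next²≢ 2F ()

mod3 : ℕ → Fin 3
mod3 zero    = 0F
mod3 (suc k) = next (mod3 k)

module Leaves (G : Graph) where

  V : Set
  V = Fin (n G)

  isLeaf : V → Bool
  isLeaf = isLeafB G

  adjLeaf : V → V → Bool
  adjLeaf v u = if adj G v u then isLeaf u else false

  leafDegree : V → ℕ
  leafDegree v = countFin (n G) (adjLeaf v)

  E-sym : ∀ {u v} → E G u v → E G v u
  E-sym {u} {v} uv = trans (Graph.sym G v u) uv

  E⇒≢ : ∀ {u v} → E G u v → u ≢ v
  E⇒≢ {u} uu refl with () ← trans (sym uu) (irrefl G u)

  isLeaf⇒degree≡1 : ∀ {v} → isLeaf v ≡ true → degree G v ≡ 1
  isLeaf⇒degree≡1 {v} leaf with degree G v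
  ... | 1 = refl

  degree≡1⇒isLeaf : ∀ {v} → degree G v ≡ 1 → isLeaf v ≡ true
  degree≡1⇒isLeaf {v} deg with degree G v
  degree≡1⇒isLeaf refl | .1 = refl

  leaf-neighbour : ∀ {v} → isLeaf v ≡ true → ∃[ u ] E G v u
  leaf-neighbour leaf = count-witness _ (≤-reflexive (sym (isLeaf⇒degree≡1 leaf)))

  leaf-neighbour-unique : ∀ {v a b} → isLeaf v ≡ true → E G v a → E G v b → a ≡ b
  leaf-neighbour-unique leaf = count≡1⇒unique _ (isLeaf⇒degree≡1 leaf)

  unique-neighbour⇒leaf : ∀ {v u} → E G v u → (∀ w → E G v w → w ≡ u) → isLeaf v ≡ true
  unique-neighbour⇒leaf vu unique = degree≡1⇒isLeaf (count≡1 _ vu unique)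

  adjLeaf⇒ : ∀ {v u} → adjLeaf v u ≡ true → E G v u × isLeaf u ≡ true
  adjLeaf⇒ {v} {u} vu with adj G v u
  ... | true = refl , vu

  adjLeaf-intro : ∀ {v u} → E G v u → isLeaf u ≡ true → adjLeaf v u ≡ true
  adjLeaf-intro vu leaf rewrite vu = leaf

  isSupport-intro : ∀ {v} → 1 ≤ leafDegree v → isSupportB G v ≡ true
  isSupport-intro {v} 1≤ℓ = anyFin-intro (adjLeaf v) (proj₂ (count-witness (adjLeaf v) 1≤ℓ))

  isSupport-false : ∀ {v} → leafDegree v ≡ 0 → isSupportB G v ≡ false
  isSupport-false {v} ℓ≡0 with isSupportB G v in supp
  ... | false = refl
  ... | true  with () ← trans (sym (proj₂ (anyFin-witness (adjLeaf v) supp)))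
                              (count≡0⇒false (adjLeaf v) ℓ≡0 _)

  no-leaf-neighbours⇒nonleaf : ∀ {x w} → leafDegree x ≡ 0 → E G x w → isLeaf w ≡ false
  no-leaf-neighbours⇒nonleaf {x} {w} ℓ≡0 xw =
    subst (λ b → (if b then isLeaf w else false) ≡ false) xw (count≡0⇒false (adjLeaf x) ℓ≡0 w)

  anyFin-at-leaf : ∀ {x p} → isLeaf x ≡ true → E G x p → (P : V → Bool) →
                   anyFin (n G) (λ q → adj G x q ∧ P q) ≡ P p
  anyFin-at-leaf {x} {p} leaf xp P with P p in Pp
  ... | true  = anyFin-intro (λ q → adj G x q ∧ P q) (cong₂ _∧_ xp Pp)
  ... | false with anyFin (n G) (λ q → adj G x q ∧ P q) in some
  ...   | false = refl
  ...   | true  with q , found ← anyFin-witness (λ q → adj G x q ∧ P q) some with ∧-true found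
  ...     | xq , Pq with () ← trans (sym (subst (λ q → P q ≡ true) (leaf-neighbour-unique leaf xq xp) Pq)) Pp

  leaf-or-not : ∀ x → isLeaf x ≡ true ⊎ isLeaf x ≡ false
  leaf-or-not x with isLeaf x
  ... | true  = inj₁ refl
  ... | false = inj₂ refl

  NonleavesHaveOneLeaf : Set
  NonleavesHaveOneLeaf = ∀ v → isLeaf v ≡ false → leafDegree v ≡ 1

  module Connectivity (conn : Connected G) where

    closed⇒all : (A : V → Bool) → (∀ {u w} → A u ≡ true → E G u w → A w ≡ true) →
                 ∀ {x} → A x ≡ true → ∀ w → A w ≡ true
    closed⇒all A closed {x} Ax w = along (conn x w) Ax
      where
      along : ∀ {a b} → Walk G a b → A a ≡ true → A b ≡ true
      along here          Aa = Aa
      along (step ab walk) Aa = along walk (closed Aa ab)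

    -- If all neighbours of v are leaves, {v} ∪ N(v) is closed under adjacency, hence is everything.
    star-bound : ∀ {v} → (∀ {w} → E G v w → isLeaf w ≡ true) → n G ≤ suc (degree G v)
    star-bound {v} all-leaves = begin
      n G                                                          ≡⟨ count-all A (closed⇒all A closed {v} (∨-introˡ (dec-true (v ≟ v) refl))) ⟨
      countFin (n G) A                                             ≤⟨ count-∨ (λ w → does (w ≟ v)) (adj G v) ⟩
      countFin (n G) (λ w → does (w ≟ v)) + degree G v             ≡⟨ cong (_+ degree G v) count-self ⟩
      suc (degree G v)                                             ∎
      where
      open ≤-Reasoning
      count-self : countFin (n G) (λ w → does (w ≟ v)) ≡ 1
      count-self = count≡1 (λ w → does (w ≟ v)) {v} (dec-true (v ≟ v) refl) (λ w → does-true⇒ (w ≟ v))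
      A : V → Bool
      A w = does (w ≟ v) ∨ adj G v w
      closed : ∀ {u w} → A u ≡ true → E G u w → A w ≡ true
      closed {u} {w} Au uw with u ≟ v | Au
      ... | yes refl | _  = trans (cong (_ ∨_) uw) (∨-zeroʳ _)
      ... | no  _    | vu = ∨-introˡ (dec-true (w ≟ v) (leaf-neighbour-unique (all-leaves vu) uw (E-sym vu)))

    leaf-neighbour-nonleaf : 3 ≤ n G → ∀ {x p} → isLeaf x ≡ true → E G x p → isLeaf p ≡ false
    leaf-neighbour-nonleaf 3≤n {x} {p} leaf-x xp with isLeaf p in leaf-p
    ... | false = refl
    ... | true  = ⊥-elim (1+n≰n (≤-trans 3≤n (subst (λ d → n G ≤ suc d) (isLeaf⇒degree≡1 leaf-x) (star-bound only-p))))
      where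
      only-p : ∀ {w} → E G x w → isLeaf w ≡ true
      only-p xw rewrite leaf-neighbour-unique leaf-x xw xp = leaf-p

    nonleaf-neighbour : 4 ≤ n G → ∀ {v} → leafDegree v ≡ 2 → ∃[ w ] E G v w × isLeaf w ≡ false
    nonleaf-neighbour 4≤n {v} ℓ≡2 with anyFin (n G) (λ w → adj G v w ∧ not (isLeaf w)) in some
    ... | true  = let w , found = anyFin-witness _ some ; vw , nonleaf = ∧-true found
                  in w , vw , not-injective nonleaf
    ... | false = ⊥-elim (1+n≰n (≤-trans 4≤n (subst (λ d → n G ≤ suc d) degree≡2 (star-bound all-leaves))))
      where
      all-leaves : ∀ {w} → E G v w → isLeaf w ≡ true
      all-leaves {w} vw = not-injective (∧-false vw (anyFin-false _ some w))
      degree≡2 : degree G v ≡ 2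
      degree≡2 = trans (sumFin-cong every-neighbour-counts) ℓ≡2
        where
        every-neighbour-counts : ∀ w → (if adj G v w then 1 else 0) ≡ (if adjLeaf v w then 1 else 0)
        every-neighbour-counts w with adj G v w in vw
        ... | true  rewrite all-leaves vw = refl
        ... | false = refl

    leaf-leafDegree : 3 ≤ n G → ∀ {x} → isLeaf x ≡ true → leafDegree x ≡ 0
    leaf-leafDegree 3≤n {x} leaf = count≡0 (adjLeaf x) no-leaf
      where
      no-leaf : ∀ u → adjLeaf x u ≡ false
      no-leaf u with adj G x u in xu
      ... | true  = leaf-neighbour-nonleaf 3≤n leaf xu
      ... | false = refl

    module _ (2≤n : 2 ≤ n G) where

      neighbour-exists : ∀ v → ∃[ u ] E G v u
      neighbour-exists v = let u , u≢v = exists-other 2≤n v in first-step (conn v u) (u≢v ∘ sym)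
        where
        first-step : ∀ {u v} → Walk G u v → u ≢ v → ∃[ w ] E G u w
        first-step here                u≢u = ⊥-elim (u≢u refl)
        first-step (step {v = w} uw _) _   = w , uw

      nonleaf-two-neighbours : ∀ {v} → isLeaf v ≡ false → ∃[ a ] ∃[ b ] a ≢ b × E G v a × E G v b
      nonleaf-two-neighbours {v} nonleaf = count-witnesses (adj G v) (≤∧≢⇒< 1≤degree degree≢1)
        where
        1≤degree : 1 ≤ degree G v
        1≤degree = count-≥1 (adj G v) (proj₂ (neighbour-exists v))
        degree≢1 : 1 ≢ degree G v
        degree≢1 1≡d with () ← trans (sym (degree≡1⇒isLeaf (sym 1≡d))) nonleaf

module Depth (G : Graph) (conn : Connected G) (root : Fin (n G)) where
  open Leaves G

  reachable : ℕ → V → Bool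
  reachable zero    v = does (v ≟ root)
  reachable (suc k) v = reachable k v ∨ anyFin (n G) (λ u → adj G v u ∧ reachable k u)

  reachable-step : ∀ k {v u} → E G v u → reachable k u ≡ true → reachable (suc k) v ≡ true
  reachable-step k {v} {u} vu reach-u =
    trans (cong (reachable k v ∨_) (anyFin-intro (λ u → adj G v u ∧ reachable k u) (cong₂ _∧_ vu reach-u)))
          (∨-zeroʳ (reachable k v))

  walkLength : ∀ {u v} → Walk G u v → ℕ
  walkLength here         = 0
  walkLength (step _ walk) = suc (walkLength walk)

  reachable-walk : ∀ {v} (walk : Walk G v root) → reachable (walkLength walk) v ≡ true
  reachable-walk here            = dec-true (root ≟ root) refl
  reachable-walk (step vu walk) = reachable-step (walkLength walk) vu (reachable-walk walk)

  private
    least-reach : ∀ v → ∃[ k ] reachable k v ≡ true × (∀ j → j < k → reachable j v ≡ false)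
    least-reach v = least-witness (λ k → reachable k v) (walkLength (conn v root)) (reachable-walk (conn v root))

  opaque
    depth : V → ℕ
    depth v = proj₁ (least-reach v)

    depth-reachable : ∀ v → reachable (depth v) v ≡ true
    depth-reachable v = proj₁ (proj₂ (least-reach v))

    depth-minimal : ∀ {v j} → j < depth v → reachable j v ≡ false
    depth-minimal {v} {j} = proj₂ (proj₂ (least-reach v)) j

  depth-≤ : ∀ {v k} → reachable k v ≡ true → depth v ≤ k
  depth-≤ {v} {k} reach with depth v ≤? k
  ... | yes d≤k = d≤k
  ... | no  d≰k with () ← trans (sym reach) (depth-minimal (≰⇒> d≰k))

  depth-adj : ∀ {v u} → E G v u → depth v ≤ suc (depth u)
  depth-adj {u = u} vu = depth-≤ (reachable-step (depth u) vu (depth-reachable u))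

  depth≡0⇒root : ∀ {v} → depth v ≡ 0 → v ≡ root
  depth≡0⇒root {v} d≡0 with v ≟ root | subst (λ k → reachable k v ≡ true) d≡0 (depth-reachable v)
  ... | yes v≡root | _ = v≡root

  parent : ∀ {v k} → depth v ≡ suc k → ∃[ u ] E G v u × depth u ≡ k
  parent {v} {k} d≡1+k
    with anyFin-witness (λ u → adj G v u ∧ reachable k u) (∨-true-¬ˡ not-within-k within-1+k)
    where
    not-within-k : reachable k v ≡ false
    not-within-k = depth-minimal (subst (k <_) (sym d≡1+k) ≤-refl)
    within-1+k : reachable (suc k) v ≡ true
    within-1+k = subst (λ j → reachable j v ≡ true) d≡1+k (depth-reachable v)
  ... | u , vu∧reach with ∧-true vu∧reach
  ... | vu , reach-u = u , vu , ≤-antisym (depth-≤ reach-u) (≤-pred (subst (_≤ suc (depth u)) d≡1+k (depth-adj vu)))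

  data Chain : V → List V → V → Set where
    edge : ∀ {x y} → E G x y → Chain x [] y
    _∷_  : ∀ {x z l y} → E G x z → Chain z l y → Chain x (z ∷ l) y

  Chain⇒Linked : ∀ {x l y} → Chain x l y → Linked (E G) (x ∷ l ++ [ y ])
  Chain⇒Linked (edge xy)  = xy ∷ [-]
  Chain⇒Linked (xz ∷ zy) = xz ∷ Chain⇒Linked zy

  _∷ʳ_ : ∀ {x l y w} → Chain x l y → E G y w → Chain x (l ++ [ y ]) w
  edge xy  ∷ʳ yw = xy ∷ edge yw
  (xz ∷ zy) ∷ʳ yw = xz ∷ (zy ∷ʳ yw)

  -- Climb from x and y towards the root in lockstep until the two branches meet.
  same-depth-chain : ∀ k {x y} → x ≢ y → depth x ≡ k → depth y ≡ k →
    ∃[ mid ] 1 ≤ length mid × Chain x mid y ×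
             Unique (x ∷ mid ++ [ y ]) × All (λ w → depth w ≤ k) (x ∷ mid ++ [ y ])
  same-depth-chain zero {x} {y} x≢y dx dy = ⊥-elim (x≢y (trans (depth≡0⇒root dx) (sym (depth≡0⇒root dy))))
  same-depth-chain (suc k) {x} {y} x≢y dx dy
    with parent dx | parent dy
  ... | px , x-px , dpx | py , y-py , dpy with px ≟ py
  ... | yes refl =
    [ px ] , s≤s z≤n , x-px ∷ edge (E-sym y-py) ,
    ((x≢depth-k dpx ∷ x≢y ∷ []) ∷ (≢y dpx ∷ []) ∷ [] ∷ []) ,
    (≤-reflexive dx ∷ ≤-trans (≤-reflexive dpx) (n≤1+n k) ∷ ≤-reflexive dy ∷ [])
    where
    x≢depth-k : ∀ {w} → depth w ≡ k → x ≢ w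
    x≢depth-k dw refl = 1+n≢n (trans (sym dx) dw)
    ≢y : ∀ {w} → depth w ≡ k → w ≢ y
    ≢y dw refl = 1+n≢n (trans (sym dy) dw)
  ... | no px≢py with same-depth-chain k px≢py dpx dpy
  ... | mid , _ , chain , unique , shallow =
    px ∷ mid ++ [ py ] , s≤s z≤n , x-px ∷ (chain ∷ʳ E-sym y-py) ,
    (++⁺ (All.map (x≢shallow) shallow) (x≢y ∷ []) ∷ AllPairs.++⁺ unique ([] ∷ []) (All.map (λ le → shallow≢y le ∷ []) shallow)) ,
    (≤-reflexive dx ∷ ++⁺ (All.map (λ le → ≤-trans le (n≤1+n k)) shallow) (≤-reflexive dy ∷ []))
    where
    x≢shallow : ∀ {w} → depth w ≤ k → x ≢ w
    x≢shallow dw refl = 1+n≰n (subst (_≤ k) dx dw)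
    shallow≢y : ∀ {w} → depth w ≤ k → w ≢ y
    shallow≢y dw refl = 1+n≰n (subst (_≤ k) dy dw)

  module _ (acyclic : Acyclic G) where

    private
      2≤length : ∀ (mid : List V) y → 1 ≤ length mid → 2 ≤ length (mid ++ [ y ])
      2≤length (_ ∷ mid) y _ = s≤s (subst (1 ≤_) (sym (trans (length-++ mid) (+-comm (length mid) 1))) (s≤s z≤n))

    adjacent-depths-differ : ∀ {x y} → E G x y → depth x ≢ depth y
    adjacent-depths-differ {x} {y} xy dx≡dy
      with mid , 1≤mid , chain , unique , _ ← same-depth-chain (depth x) (E⇒≢ xy) refl (sym dx≡dy) =
      acyclic (x ∷ mid ++ [ y ]) (2≤length mid y 1≤mid , unique , Chain⇒Linked (chain ∷ʳ E-sym xy))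

    parent-unique : ∀ {v x y} → E G v x → E G v y → depth v ≡ suc (depth x) → depth v ≡ suc (depth y) → x ≡ y
    parent-unique {v} {x} {y} vx vy dvx dvy with x ≟ y
    ... | yes x≡y = x≡y
    ... | no  x≢y
      with mid , 1≤mid , chain , unique , shallow ← same-depth-chain (depth x) x≢y refl (suc-injective (trans (sym dvy) dvx)) =
      ⊥-elim (acyclic (v ∷ x ∷ mid ++ [ y ])
        (s≤s (≤-trans (s≤s z≤n) (2≤length mid y 1≤mid)) ,
         All.map v≢shallow shallow ∷ unique ,
         Chain⇒Linked (vx ∷ (chain ∷ʳ E-sym vy))))
      where
      v≢shallow : ∀ {w} → depth w ≤ depth x → v ≢ w
      v≢shallow dw refl = 1+n≰n (subst (_≤ depth x) dvx dw)

    adjacent-depths : ∀ {x y} → E G x y → depth x ≡ suc (depth y) ⊎ depth y ≡ suc (depth x)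
    adjacent-depths {x} {y} xy with <-cmp (depth x) (depth y)
    ... | tri< dx<dy _ _ = inj₂ (≤-antisym (depth-adj (E-sym xy)) dx<dy)
    ... | tri≈ _ dx≡dy _ = ⊥-elim (adjacent-depths-differ xy dx≡dy)
    ... | tri> _ _ dy<dx = inj₁ (≤-antisym (depth-adj xy) dy<dx)

module Charge (G : Graph) where
  open Leaves G

  charge : (V → ℕ) → V → ℕ
  charge h v = (if isLeaf v then 0 else h v) + sumFin (n G) (λ u → if adjLeaf v u then h u else 0)

  collected-once : ∀ (h : V → ℕ) u → sumFin (n G) (λ v → if adjLeaf v u then h u else 0) ≡ (if isLeaf u then h u else 0)
  collected-once h u with leaf-or-not u
  ... | inj₂ nonleaf = trans (sumFin-zero nothing-collected) (cong (λ b → if b then h u else 0) (sym nonleaf))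
    where
    nothing-collected : ∀ v → (if adjLeaf v u then h u else 0) ≡ 0
    nothing-collected v with adj G v u
    ... | true  = cong (λ b → if b then h u else 0) nonleaf
    ... | false = refl
  ... | inj₁ leaf = begin
    sumFin (n G) (λ v → if adjLeaf v u then h u else 0)  ≡⟨ sumFin-cong collected-from-neighbours ⟩
    sumFin (n G) (λ v → if adj G v u then h u else 0)    ≡⟨ sumFin-if (λ v → adj G v u) (h u) ⟩
    h u * countFin (n G) (λ v → adj G v u)               ≡⟨ cong (h u *_) (sumFin-cong in-degree≡degree) ⟩
    h u * degree G u                                     ≡⟨ cong (h u *_) (isLeaf⇒degree≡1 leaf) ⟩
    h u * 1                                              ≡⟨ *-identityʳ (h u) ⟩
    h u                                                  ≡⟨ cong (λ b → if b then h u else 0) leaf ⟨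
    (if isLeaf u then h u else 0)                        ∎
    where
    open ≡-Reasoning
    collected-from-neighbours : ∀ v → (if adjLeaf v u then h u else 0) ≡ (if adj G v u then h u else 0)
    collected-from-neighbours v with adj G v u
    ... | true  = cong (λ b → if b then h u else 0) leaf
    ... | false = refl
    in-degree≡degree : ∀ v → (if adj G v u then 1 else 0) ≡ (if adj G u v then 1 else 0)
    in-degree≡degree v = cong (λ b → if b then 1 else 0) (Graph.sym G v u)

  sumFin-charge : ∀ (h : V → ℕ) → sumFin (n G) (charge h) ≡ sumFin (n G) h
  sumFin-charge h = begin
    sumFin (n G) (charge h)
      ≡⟨ sumFin-+ {n G} (λ v → if isLeaf v then 0 else h v) (λ v → sumFin (n G) (λ u → if adjLeaf v u then h u else 0)) ⟩
    sumFin (n G) (λ v → if isLeaf v then 0 else h v) + sumFin (n G) (λ v → sumFin (n G) (λ u → if adjLeaf v u then h u else 0))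
      ≡⟨ cong (sumFin (n G) (λ v → if isLeaf v then 0 else h v) +_) (trans (sumFin-comm (λ v u → if adjLeaf v u then h u else 0)) (sumFin-cong (collected-once h))) ⟩
    sumFin (n G) (λ v → if isLeaf v then 0 else h v) + sumFin (n G) (λ u → if isLeaf u then h u else 0)
      ≡⟨ sumFin-+ {n G} (λ v → if isLeaf v then 0 else h v) (λ v → if isLeaf v then h v else 0) ⟨
    sumFin (n G) (λ v → (if isLeaf v then 0 else h v) + (if isLeaf v then h v else 0))
      ≡⟨ sumFin-cong split ⟩
    sumFin (n G) h ∎
    where
    open ≡-Reasoning
    split : ∀ v → (if isLeaf v then 0 else h v) + (if isLeaf v then h v else 0) ≡ h v
    split v with isLeaf v
    ... | true  = refl
    ... | false = +-identityʳ (h v)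

  budget : V → ℕ
  budget v = charge (λ _ → 3) v + (if isSupportB G v then 2 else 0)

  sumFin-budget : sumFin (n G) budget ≡ 3 * n G + 2 * supportCount G
  sumFin-budget = begin
    sumFin (n G) budget
      ≡⟨ sumFin-+ {n G} (charge (λ _ → 3)) (λ v → if isSupportB G v then 2 else 0) ⟩
    sumFin (n G) (charge (λ _ → 3)) + sumFin (n G) (λ v → if isSupportB G v then 2 else 0)
      ≡⟨ cong₂ _+_ (sumFin-charge (λ _ → 3)) (sumFin-if (isSupportB G) 2) ⟩
    sumFin (n G) (λ _ → 3 * 1) + 2 * supportCount G
      ≡⟨ cong (_+ 2 * supportCount G) (trans (sumFin-*ˡ {n G} 3 (λ _ → 1)) (cong (3 *_) (sumFin-one (n G)))) ⟩
    3 * n G + 2 * supportCount G ∎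
    where open ≡-Reasoning

  charge-no-leaf-neighbours : ∀ (h : V → ℕ) {v} → leafDegree v ≡ 0 → charge h v ≡ (if isLeaf v then 0 else h v)
  charge-no-leaf-neighbours h {v} ℓ≡0 =
    trans (cong ((if isLeaf v then 0 else h v) +_) (sumFin-zero nothing))
          (+-identityʳ _)
    where
    nothing : ∀ u → (if adjLeaf v u then h u else 0) ≡ 0
    nothing u = cong (λ b → if b then h u else 0) (count≡0⇒false (adjLeaf v) ℓ≡0 u)

  charge-leaf : ∀ (h : V → ℕ) {v} → isLeaf v ≡ true → leafDegree v ≡ 0 → charge h v ≡ 0
  charge-leaf h {v} leaf ℓ≡0 = trans (charge-no-leaf-neighbours h ℓ≡0) (cong (λ b → if b then 0 else h v) leaf)

  charge-one-leaf : ∀ (h : V → ℕ) {v u} → leafDegree v ≡ 1 → adjLeaf v u ≡ true →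
                    charge h v ≡ (if isLeaf v then 0 else h v) + h u
  charge-one-leaf h {v} {u} ℓ≡1 vu = cong ((if isLeaf v then 0 else h v) +_) (trans (sumFin-single u elsewhere) at-u)
    where
    elsewhere : ∀ w → w ≢ u → (if adjLeaf v w then h w else 0) ≡ 0
    elsewhere w w≢u with adjLeaf v w in vw
    ... | true  = ⊥-elim (w≢u (count≡1⇒unique (adjLeaf v) ℓ≡1 vw vu))
    ... | false = refl
    at-u : (if adjLeaf v u then h u else 0) ≡ h u
    at-u = cong (λ b → if b then h u else 0) vu

  charge-const : ∀ c v → charge (λ _ → c) v ≡ (if isLeaf v then 0 else c) + c * leafDegree v
  charge-const c v = cong ((if isLeaf v then 0 else c) +_) (sumFin-if (adjLeaf v) c)

  budget-leaf : ∀ {v} → isLeaf v ≡ true → leafDegree v ≡ 0 → budget v ≡ 0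
  budget-leaf {v} leaf ℓ≡0 rewrite charge-const 3 v | leaf | ℓ≡0 | isSupport-false ℓ≡0 = refl

  budget-no-leaves : ∀ {v} → isLeaf v ≡ false → leafDegree v ≡ 0 → budget v ≡ 3
  budget-no-leaves {v} nonleaf ℓ≡0 rewrite charge-const 3 v | nonleaf | ℓ≡0 | isSupport-false ℓ≡0 = refl

  budget-support : ∀ {v} → isLeaf v ≡ false → 1 ≤ leafDegree v → budget v ≡ (3 + 3 * leafDegree v) + 2
  budget-support {v} nonleaf 1≤ℓ rewrite charge-const 3 v | nonleaf | isSupport-intro 1≤ℓ = refl

module LeafRooted (G : Graph) (conn : Connected G) (acyclic : Acyclic G) (2≤n : 2 ≤ n G) where
  open Leaves G

  module _ (r : V) where
    open Depth G conn r

    deepest : V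
    deepest = argmax depth r (allFin (n G))

    deepest-maximal : ∀ v → depth v ≤ depth deepest
    deepest-maximal v = All.lookup (f[xs]≤f[argmax] r (allFin (n G))) (∈-allFin v)

    deepest-isLeaf : isLeaf deepest ≡ true
    deepest-isLeaf with depth deepest in d≡
    ... | zero  = let other , other≢r = exists-other 2≤n r in ⊥-elim (other≢r (trans (at-root other) (sym (at-root r))))
      where
      at-root : ∀ v → v ≡ r
      at-root v = depth≡0⇒root (n≤0⇒n≡0 (subst (depth v ≤_) d≡ (deepest-maximal v)))
    ... | suc k = let p , deepest-p , dp = parent d≡ in unique-neighbour⇒leaf deepest-p (only-parent p deepest-p dp)
      where
      only-parent : ∀ p → E G deepest p → depth p ≡ k → ∀ w → E G deepest w → w ≡ p
      only-parent p deepest-p dp w deepest-w with adjacent-depths acyclic deepest-w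
      ... | inj₁ d≡1+dw = parent-unique acyclic deepest-w deepest-p d≡1+dw (trans d≡ (cong suc (sym dp)))
      ... | inj₂ dw≡1+d = ⊥-elim (1+n≰n (subst (_≤ depth deepest) dw≡1+d (deepest-maximal w)))

  -- Opaque, so that colour computations never unfold the argmax behind ρ.
  opaque
    ρ : V
    ρ = deepest (fromℕ< (≤-trans (s≤s z≤n) 2≤n))

    ρ-isLeaf : isLeaf ρ ≡ true
    ρ-isLeaf = deepest-isLeaf _

  open Depth G conn ρ
  open Connectivity conn

  colour : V → Fin 3
  colour v = mod3 (depth v)

  colour-adj : ∀ {u v} → E G u v → colour u ≢ colour v
  colour-adj {u} {v} uv with adjacent-depths acyclic uv
  ... | inj₁ du≡1+dv = subst (λ d → mod3 d ≢ colour v) (sym du≡1+dv) (next≢ (colour v))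
  ... | inj₂ dv≡1+du = subst (λ d → colour u ≢ mod3 d) (sym dv≡1+du) (next≢ (colour u) ∘ sym)

  nonleaf-depth : ∀ {x} → isLeaf x ≡ false → ∃[ k ] depth x ≡ suc k
  nonleaf-depth {x} nonleaf with depth x in dx
  ... | suc k = k , refl
  ... | zero with () ← trans (sym nonleaf) (subst (λ v → isLeaf v ≡ true) (sym (depth≡0⇒root dx)) ρ-isLeaf)

  child : ∀ {x k} → isLeaf x ≡ false → depth x ≡ suc k → ∃[ w ] E G x w × depth w ≡ suc (suc k)
  child {x} {k} nonleaf dx = pick (parent dx) (nonleaf-two-neighbours 2≤n nonleaf)
    where
    not-parent : ∀ {p w} → E G x p → depth p ≡ k → E G x w → w ≢ p → depth w ≡ suc (suc k)
    not-parent xp dp xw w≢p with adjacent-depths acyclic xw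
    ... | inj₂ dw≡1+dx = trans dw≡1+dx (cong suc dx)
    ... | inj₁ dx≡1+dw = ⊥-elim (w≢p (parent-unique acyclic xw xp dx≡1+dw (trans dx (cong suc (sym dp)))))
    pick : (∃[ p ] E G x p × depth p ≡ k) → (∃[ a ] ∃[ b ] a ≢ b × E G x a × E G x b) →
           ∃[ w ] E G x w × depth w ≡ suc (suc k)
    pick (p , xp , dp) (a , b , a≢b , xa , xb) with a ≟ p
    ... | yes refl = b , xb , not-parent xp dp xb (a≢b ∘ sym)
    ... | no  a≢p  = a , xa , not-parent xp dp xa a≢p

  colour-grandchild : ∀ {p w k} → depth p ≡ k → depth w ≡ suc (suc k) → colour w ≡ next (next (colour p))
  colour-grandchild dp dw rewrite dp | dw = refl

  colour-avoiding-neighbour : ∀ {x} → isLeaf x ≡ false → ∀ i → ∃[ w ] E G x w × colour w ≢ i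
  colour-avoiding-neighbour {x} nonleaf i = pick (parent dx) (child nonleaf dx)
    where
    k : ℕ
    k = proj₁ (nonleaf-depth nonleaf)
    dx : depth x ≡ suc k
    dx = proj₂ (nonleaf-depth nonleaf)
    pick : (∃[ p ] E G x p × depth p ≡ k) → (∃[ w ] E G x w × depth w ≡ suc (suc k)) → ∃[ w ] E G x w × colour w ≢ i
    pick (p , xp , dp) (w , xw , dw) with colour p ≟ i
    ... | no  cp≢i = p , xp , cp≢i
    ... | yes cp≡i = w , xw , λ cw≡i → next²≢ (colour p) (trans (sym (colour-grandchild dp dw)) (trans cw≡i (sym cp≡i)))

module ColouredTR2DFs (G : Graph) (conn : Connected G) (acyclic : Acyclic G) (3≤n : 3 ≤ n G) where
  open Leaves G
  open Connectivity conn
  open LeafRooted G conn acyclic (≤-trans (n≤1+n 2) 3≤n) using (colour; colour-adj; colour-avoiding-neighbour)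

  nonleafValue : ℕ → Bool → ℕ
  nonleafValue zero          away = if away then 1 else 0
  nonleafValue (suc zero)    _    = 1
  nonleafValue (suc (suc _)) _    = 2

  hubValue : Fin 3 → V → ℕ
  hubValue i x = nonleafValue (leafDegree x) (not (does (colour x ≟ i)))

  activeNeighbour : Fin 3 → V → V → Bool
  activeNeighbour i p w = adj G p w ∧ (not (isLeaf w) ∧ not (does (hubValue i w ≟ℕ 0)))

  bad : Fin 3 → V → Bool
  bad i p = not (anyFin (n G) (activeNeighbour i p))

  leafGetsOne : Fin 3 → V → V → Bool
  leafGetsOne i x p = does (leafDegree p ≟ℕ 1) ∨ (isFirst (adjLeaf p) x ∧ bad i p)

  f : Fin 3 → V → ℕ
  f i x = if isLeaf x then (if anyFin (n G) (λ p → adj G x p ∧ leafGetsOne i x p) then 1 else 0) else hubValue i x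

  f-nonleaf : ∀ i {x} → isLeaf x ≡ false → f i x ≡ hubValue i x
  f-nonleaf i nonleaf rewrite nonleaf = refl

  f-leaf : ∀ i {x p} → isLeaf x ≡ true → E G x p → f i x ≡ (if leafGetsOne i x p then 1 else 0)
  f-leaf i {x} leaf xp rewrite leaf = cong (λ b → if b then 1 else 0) (anyFin-at-leaf leaf xp (leafGetsOne i x))

  private
    2≤n : 2 ≤ n G
    2≤n = ≤-trans (n≤1+n 2) 3≤n

  support-nonleaf : ∀ {x p} → isLeaf x ≡ true → E G x p → isLeaf p ≡ false
  support-nonleaf = leaf-neighbour-nonleaf 3≤n

  support-leafDegree : ∀ {x p} → isLeaf x ≡ true → E G x p → 1 ≤ leafDegree p
  support-leafDegree {x} {p} leaf xp = count-≥1 (adjLeaf p) (adjLeaf-intro (E-sym xp) leaf)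

  nonleafValue≤2 : ∀ k b → nonleafValue k b ≤ 2
  nonleafValue≤2 zero          true  = s≤s z≤n
  nonleafValue≤2 zero          false = z≤n
  nonleafValue≤2 (suc zero)    _     = s≤s z≤n
  nonleafValue≤2 (suc (suc _)) _     = ≤-refl

  nonleafValue-positive : ∀ k b → b ≡ true ⊎ 1 ≤ k → nonleafValue k b ≡ 1 ⊎ nonleafValue k b ≡ 2
  nonleafValue-positive zero          true  _ = inj₁ refl
  nonleafValue-positive zero          false (inj₁ ())
  nonleafValue-positive (suc zero)    _     _ = inj₁ refl
  nonleafValue-positive (suc (suc _)) _     _ = inj₂ refl

  nonleafValue-≥2 : ∀ k b → 2 ≤ k → nonleafValue k b ≡ 2
  nonleafValue-≥2 (suc (suc _)) _ _         = refl
  nonleafValue-≥2 (suc zero)    _ (s≤s ())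

  hubValue≡0 : ∀ i x → hubValue i x ≡ 0 → leafDegree x ≡ 0 × colour x ≡ i
  hubValue≡0 i x value≡0 with leafDegree x | colour x ≟ i | value≡0
  ... | zero          | yes cx≡i | _  = refl , cx≡i
  ... | zero          | no  _    | ()
  ... | suc zero      | _        | ()
  ... | suc (suc _)   | _        | ()

  1or2⇒≢0 : ∀ {k} → k ≡ 1 ⊎ k ≡ 2 → k ≢ 0
  1or2⇒≢0 (inj₁ refl) ()
  1or2⇒≢0 (inj₂ refl) ()

  support-positive : ∀ i {x p} → isLeaf x ≡ true → E G x p → f i p ≡ 1 ⊎ f i p ≡ 2
  support-positive i {x} {p} leaf xp rewrite f-nonleaf i (support-nonleaf leaf xp) =
    nonleafValue-positive (leafDegree p) _ (inj₂ (support-leafDegree leaf xp))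

  away-positive : ∀ i {w} → isLeaf w ≡ false → colour w ≢ i → f i w ≡ 1 ⊎ f i w ≡ 2
  away-positive i {w} nonleaf cw≢i rewrite f-nonleaf i nonleaf | dec-false (colour w ≟ i) cw≢i =
    nonleafValue-positive (leafDegree w) true (inj₁ refl)

  leaf-gets-one : ∀ i {x u} → adjLeaf x u ≡ true → leafGetsOne i u x ≡ true → f i u ≡ 1
  leaf-gets-one i {x} {u} xu gets with adjLeaf⇒ xu
  ... | xu′ , leaf rewrite f-leaf i leaf (E-sym xu′) | gets = refl

  f≤2 : ∀ i x → f i x ≤ 2
  f≤2 i x with isLeaf x
  ... | true  = ≤-trans (𝟙≤1 _) (n≤1+n 1)
  ... | false = nonleafValue≤2 (leafDegree x) _

  Dominated : (V → ℕ) → V → Set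
  Dominated h x = (∃[ u ] (E G x u × h u ≡ 2)) ⊎ (∃[ a ] ∃[ b ] (a ≢ b × E G x a × E G x b × h a ≡ 1 × h b ≡ 1))

  dominated : ∀ i x → f i x ≡ 0 → Dominated (f i) x
  dominated i x fx≡0 with leaf-or-not x
  ... | inj₁ leaf = inj₁ (via-support (leaf-neighbour leaf))
    where
    via-support : ∃[ p ] E G x p → ∃[ u ] E G x u × f i u ≡ 2
    via-support (p , xp) = p , xp , trans (f-nonleaf i (support-nonleaf leaf xp)) (nonleafValue-≥2 (leafDegree p) _ 2≤ℓ)
      where
      gets-nothing : leafGetsOne i x p ≡ false
      gets-nothing = 𝟙≡0⇒false (trans (sym (f-leaf i leaf xp)) fx≡0)
      2≤ℓ : 2 ≤ leafDegree p
      2≤ℓ = ≤∧≢⇒< (support-leafDegree leaf xp) (does-false⇒¬ (leafDegree p ≟ℕ 1) (∨-conicalˡ _ _ gets-nothing) ∘ sym)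
  ... | inj₂ nonleaf = via-neighbours (nonleaf-two-neighbours 2≤n nonleaf)
    where
    no-leaves×colour-i : leafDegree x ≡ 0 × colour x ≡ i
    no-leaves×colour-i = hubValue≡0 i x (trans (sym (f-nonleaf i nonleaf)) fx≡0)
    positive : ∀ {w} → E G x w → f i w ≡ 1 ⊎ f i w ≡ 2
    positive xw = away-positive i (no-leaf-neighbours⇒nonleaf (proj₁ no-leaves×colour-i) xw)
                    (λ cw≡i → colour-adj xw (trans (proj₂ no-leaves×colour-i) (sym cw≡i)))
    via-neighbours : ∃[ a ] ∃[ b ] a ≢ b × E G x a × E G x b → Dominated (f i) x
    via-neighbours (a , b , a≢b , xa , xb) with positive xa | positive xb
    ... | inj₂ fa≡2 | _         = inj₁ (a , xa , fa≡2)
    ... | inj₁ _    | inj₂ fb≡2 = inj₁ (b , xb , fb≡2)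
    ... | inj₁ fa≡1 | inj₁ fb≡1 = inj₂ (a , b , a≢b , xa , xb , fa≡1 , fb≡1)

  supported : ∀ i x → f i x ≢ 0 → ∃[ u ] E G x u × f i u ≢ 0
  supported i x fx≢0 with leaf-or-not x
  ... | inj₁ leaf    = let p , xp = leaf-neighbour leaf in p , xp , 1or2⇒≢0 (support-positive i leaf xp)
  ... | inj₂ nonleaf = by-leafDegree (leafDegree x) refl
    where
    via-leaf : ∀ {u} → adjLeaf x u ≡ true → leafGetsOne i u x ≡ true → ∃[ u ] E G x u × f i u ≢ 0
    via-leaf {u} xu gets = u , proj₁ (adjLeaf⇒ xu) , 1or2⇒≢0 (inj₁ (leaf-gets-one i xu gets))

    by-leafDegree : ∀ k → leafDegree x ≡ k → ∃[ u ] E G x u × f i u ≢ 0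
    by-leafDegree zero ℓ≡0 =
      let w , xw , cw≢i = colour-avoiding-neighbour nonleaf i
      in w , xw , 1or2⇒≢0 (away-positive i (no-leaf-neighbours⇒nonleaf ℓ≡0 xw) cw≢i)
    by-leafDegree (suc zero) ℓ≡1 =
      let u , xu = count-witness (adjLeaf x) (≤-reflexive (sym ℓ≡1))
      in via-leaf xu (∨-introˡ (dec-true (leafDegree x ≟ℕ 1) ℓ≡1))
    by-leafDegree (suc (suc k)) ℓ≡2+k
      with anyFin (n G) (activeNeighbour i x) in active
    ... | true  =
      let w , found = anyFin-witness (activeNeighbour i x) active
          xw , rest = ∧-true found
          nonleaf-w , positive = ∧-true rest
      in w , xw , λ fw≡0 → does-false⇒¬ (hubValue i w ≟ℕ 0) (not-injective positive)
                              (trans (sym (f-nonleaf i (not-injective nonleaf-w))) fw≡0)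
    ... | false =
      let u , xu = count-witness (adjLeaf x) (subst (1 ≤_) (sym ℓ≡2+k) (s≤s z≤n))
          u₁ , first = isFirst-exists (adjLeaf x) xu
      in via-leaf {u₁} (isFirst⇒true (adjLeaf x) first) (∨-introʳ (cong₂ _∧_ first (cong not active)))

  f-isTR2DF : ∀ i → IsTR2DF G (f i)
  f-isTR2DF i = f≤2 i , dominated i , supported i

module Discharging (G : Graph) (conn : Connected G) (acyclic : Acyclic G) (4≤n : 4 ≤ n G) where
  open Leaves G
  open Connectivity conn
  open Charge G
  open LeafRooted G conn acyclic (≤-trans (n≤1+n 2) (≤-trans (n≤1+n 3) 4≤n)) using (colour)
  open ColouredTR2DFs G conn acyclic (≤-trans (n≤1+n 3) 4≤n)

  private
    3≤n : 3 ≤ n G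
    3≤n = ≤-trans (n≤1+n 3) 4≤n

  total : V → ℕ
  total v = sumFin 3 (λ i → f i v)

  hubTotal : ℕ → ℕ
  hubTotal zero          = 2
  hubTotal (suc zero)    = 3
  hubTotal (suc (suc _)) = 6

  total-nonleaf : ∀ {v} → isLeaf v ≡ false → total v ≡ hubTotal (leafDegree v)
  total-nonleaf {v} nonleaf = trans (sumFin-cong (λ i → f-nonleaf i nonleaf)) (sum-over-colours (leafDegree v) (colour v))
    where
    sum-over-colours : ∀ k c → sumFin 3 (λ i → nonleafValue k (not (does (c ≟ i)))) ≡ hubTotal k
    sum-over-colours zero          0F = refl
    sum-over-colours zero          1F = refl
    sum-over-colours zero          2F = refl
    sum-over-colours (suc zero)    _  = refl
    sum-over-colours (suc (suc _)) _  = refl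

  badCount : V → ℕ
  badCount v = countFin 3 (λ i → bad i v)

  total-leaf : ∀ {v u} → adjLeaf v u ≡ true → 2 ≤ leafDegree v → total u ≡ (if isFirst (adjLeaf v) u then badCount v else 0)
  total-leaf {v} {u} vu 2≤ℓ with adjLeaf⇒ vu
  ... | vu′ , leaf = trans (sumFin-cong at-colour) (first-gets-all (isFirst (adjLeaf v) u))
    where
    not-one : does (leafDegree v ≟ℕ 1) ≡ false
    not-one = dec-false (leafDegree v ≟ℕ 1) λ ℓ≡1 → 1+n≰n (subst (2 ≤_) ℓ≡1 2≤ℓ)
    at-colour : ∀ i → f i u ≡ (if isFirst (adjLeaf v) u ∧ bad i v then 1 else 0)
    at-colour i = trans (f-leaf i leaf (E-sym vu′)) (cong (λ b → if b ∨ (isFirst (adjLeaf v) u ∧ bad i v) then 1 else 0) not-one)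
    first-gets-all : ∀ b → sumFin 3 (λ i → if b ∧ bad i v then 1 else 0) ≡ (if b then badCount v else 0)
    first-gets-all true  = refl
    first-gets-all false = refl

  total-leaf-single : ∀ {v u} → adjLeaf v u ≡ true → leafDegree v ≡ 1 → total u ≡ 3
  total-leaf-single {v} {u} vu ℓ≡1 with adjLeaf⇒ vu
  ... | vu′ , leaf = sumFin-cong {g = λ _ → 1} λ i →
          trans (f-leaf i leaf (E-sym vu′)) (cong (λ b → if b ∨ (isFirst (adjLeaf v) u ∧ bad i v) then 1 else 0) (dec-true (leafDegree v ≟ℕ 1) ℓ≡1))

  badCount≤3 : ∀ v → badCount v ≤ 3
  badCount≤3 v = sumFin-mono {g = λ _ → 1} (λ i → 𝟙≤1 (bad i v))

  bad⇒colour : ∀ {v w} → E G v w → isLeaf w ≡ false → ∀ i → bad i v ≡ true → colour w ≡ i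
  bad⇒colour {v} {w} vw nonleaf i bad-i = proj₂ (hubValue≡0 i w (does-true⇒ (hubValue i w ≟ℕ 0) (not-injective at-w)))
    where
    at-w : not (does (hubValue i w ≟ℕ 0)) ≡ false
    at-w = ∧-false (cong not nonleaf) (∧-false vw (anyFin-false _ (not-injective bad-i) w))

  badCount≤1 : ∀ {v w} → E G v w → isLeaf w ≡ false → badCount v ≤ 1
  badCount≤1 {v} {w} vw nonleaf = ≤-trans (count-mono (λ i → bad i v) (λ i → does (i ≟ colour w)) bad⇒is-colour)
                                           (≤-reflexive (count≡1 (λ i → does (i ≟ colour w)) (dec-true (colour w ≟ colour w) refl) (λ i → does-true⇒ (i ≟ colour w))))
    where
    bad⇒is-colour : ∀ i → bad i v ≡ true → does (i ≟ colour w) ≡ true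
    bad⇒is-colour i bad-i = dec-true (i ≟ colour w) (sym (bad⇒colour vw nonleaf i bad-i))

  charge-total-no-leaves : ∀ {v} → isLeaf v ≡ false → leafDegree v ≡ 0 → charge total v ≡ 2
  charge-total-no-leaves {v} nonleaf ℓ≡0 = begin
    charge total v                    ≡⟨ charge-no-leaf-neighbours total ℓ≡0 ⟩
    (if isLeaf v then 0 else total v) ≡⟨ cong (λ b → if b then 0 else total v) nonleaf ⟩
    total v                           ≡⟨ total-nonleaf nonleaf ⟩
    hubTotal (leafDegree v)           ≡⟨ cong hubTotal ℓ≡0 ⟩
    2                                 ∎
    where open ≡-Reasoning

  charge-total-single : ∀ {v} → isLeaf v ≡ false → leafDegree v ≡ 1 → charge total v ≡ 6
  charge-total-single {v} nonleaf ℓ≡1 = cong₂ _+_ hub leaves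
    where
    hub : (if isLeaf v then 0 else total v) ≡ 3
    hub = trans (cong (λ b → if b then 0 else total v) nonleaf) (trans (total-nonleaf nonleaf) (cong hubTotal ℓ≡1))
    each-leaf : ∀ u → (if adjLeaf v u then total u else 0) ≡ (if adjLeaf v u then 3 else 0)
    each-leaf u with adjLeaf v u in vu
    ... | true  = total-leaf-single vu ℓ≡1
    ... | false = refl
    leaves : sumFin (n G) (λ u → if adjLeaf v u then total u else 0) ≡ 3
    leaves = trans (sumFin-cong each-leaf) (trans (sumFin-if (adjLeaf v) 3) (cong (3 *_) ℓ≡1))

  charge-total-many : ∀ {v} → isLeaf v ≡ false → 2 ≤ leafDegree v → charge total v ≤ 6 + badCount v
  charge-total-many {v} nonleaf 2≤ℓ = +-mono-≤ (≤-reflexive hub) leaves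
    where
    hub : (if isLeaf v then 0 else total v) ≡ 6
    hub = trans (cong (λ b → if b then 0 else total v) nonleaf) (trans (total-nonleaf nonleaf) (many (leafDegree v) 2≤ℓ))
      where
      many : ∀ k → 2 ≤ k → hubTotal k ≡ 6
      many (suc (suc _)) _        = refl
      many (suc zero)    (s≤s ())
    each-leaf : ∀ u → (if adjLeaf v u then total u else 0) ≤ (if isFirst (adjLeaf v) u then badCount v else 0)
    each-leaf u with adjLeaf v u in vu
    ... | true  = ≤-reflexive (total-leaf vu 2≤ℓ)
    ... | false = z≤n
    leaves : sumFin (n G) (λ u → if adjLeaf v u then total u else 0) ≤ badCount v
    leaves = begin
      sumFin (n G) (λ u → if adjLeaf v u then total u else 0)          ≤⟨ sumFin-mono each-leaf ⟩
      sumFin (n G) (λ u → if isFirst (adjLeaf v) u then badCount v else 0) ≡⟨ sumFin-if (isFirst (adjLeaf v)) (badCount v) ⟩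
      badCount v * countFin (n G) (isFirst (adjLeaf v))                 ≤⟨ *-monoʳ-≤ (badCount v) (count-isFirst≤1 (adjLeaf v)) ⟩
      badCount v * 1                                                    ≡⟨ *-identityʳ (badCount v) ⟩
      badCount v                                                        ∎
      where open ≤-Reasoning

  charge-≡-budget : ∀ {v} → isLeaf v ≡ false → leafDegree v ≡ 1 → 4 * charge total v ≡ 3 * budget v
  charge-≡-budget {v} nonleaf ℓ≡1 = begin
    4 * charge total v                  ≡⟨ cong (4 *_) (charge-total-single nonleaf ℓ≡1) ⟩
    3 * ((3 + 3 * 1) + 2)               ≡⟨ cong (λ k → 3 * ((3 + 3 * k) + 2)) ℓ≡1 ⟨
    3 * ((3 + 3 * leafDegree v) + 2)    ≡⟨ cong (3 *_) (budget-support nonleaf (≤-reflexive (sym ℓ≡1))) ⟨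
    3 * budget v                        ∎
    where open ≡-Reasoning

  charge-<-budget : ∀ {v} → isLeaf v ≡ false → leafDegree v ≢ 1 → 4 * charge total v < 3 * budget v
  charge-<-budget {v} nonleaf ℓ≢1 = by-leafDegree (leafDegree v) refl
    where
    open ≤-Reasoning
    by-leafDegree : ∀ k → leafDegree v ≡ k → 4 * charge total v < 3 * budget v
    by-leafDegree zero ℓ≡0 = begin-strict
      4 * charge total v  ≡⟨ cong (4 *_) (charge-total-no-leaves nonleaf ℓ≡0) ⟩
      8                   <⟨ ≤-refl ⟩
      9                   ≡⟨ cong (3 *_) (budget-no-leaves nonleaf ℓ≡0) ⟨
      3 * budget v        ∎
    by-leafDegree (suc zero) ℓ≡1 = ⊥-elim (ℓ≢1 ℓ≡1)
    by-leafDegree (suc (suc zero)) ℓ≡2 =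
      let w , vw , nonleaf-w = nonleaf-neighbour 4≤n ℓ≡2 in begin-strict
      4 * charge total v                ≤⟨ *-monoʳ-≤ 4 (charge-total-many nonleaf (≤-reflexive (sym ℓ≡2))) ⟩
      4 * (6 + badCount v)              ≤⟨ *-monoʳ-≤ 4 (+-monoʳ-≤ 6 (badCount≤1 vw nonleaf-w)) ⟩
      28                                <⟨ +-monoʳ-≤ 29 (z≤n {4}) ⟩
      3 * ((3 + 3 * 2) + 2)             ≡⟨ cong (λ k → 3 * ((3 + 3 * k) + 2)) ℓ≡2 ⟨
      3 * ((3 + 3 * leafDegree v) + 2)  ≡⟨ cong (3 *_) (budget-support nonleaf (subst (1 ≤_) (sym ℓ≡2) (s≤s z≤n))) ⟨
      3 * budget v                      ∎
    by-leafDegree k@(suc (suc (suc _))) ℓ≡k = begin-strict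
      4 * charge total v                ≤⟨ *-monoʳ-≤ 4 (charge-total-many nonleaf (subst (2 ≤_) (sym ℓ≡k) (s≤s (s≤s z≤n)))) ⟩
      4 * (6 + badCount v)              ≤⟨ *-monoʳ-≤ 4 (+-monoʳ-≤ 6 (badCount≤3 v)) ⟩
      36                                <⟨ +-monoʳ-≤ 37 (z≤n {5}) ⟩
      3 * ((3 + 3 * 3) + 2)             ≤⟨ *-monoʳ-≤ 3 (+-monoˡ-≤ 2 (+-monoʳ-≤ 3 (*-monoʳ-≤ 3 (s≤s (s≤s (s≤s z≤n)))))) ⟩
      3 * ((3 + 3 * k) + 2)             ≡⟨ cong (λ k → 3 * ((3 + 3 * k) + 2)) ℓ≡k ⟨
      3 * ((3 + 3 * leafDegree v) + 2)  ≡⟨ cong (3 *_) (budget-support nonleaf (subst (1 ≤_) (sym ℓ≡k) (s≤s z≤n))) ⟨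
      3 * budget v                      ∎

  charge-≤-budget : ∀ v → 4 * charge total v ≤ 3 * budget v
  charge-≤-budget v with leaf-or-not v
  ... | inj₁ leaf = ≤-reflexive (trans (cong (4 *_) (charge-leaf total leaf ℓ≡0)) (sym (cong (3 *_) (budget-leaf leaf ℓ≡0))))
    where
    ℓ≡0 : leafDegree v ≡ 0
    ℓ≡0 = leaf-leafDegree 3≤n leaf
  ... | inj₂ nonleaf with leafDegree v ≟ℕ 1
  ...   | yes ℓ≡1 = ≤-reflexive (charge-≡-budget nonleaf ℓ≡1)
  ...   | no  ℓ≢1 = <⇒≤ (charge-<-budget nonleaf ℓ≢1)

  private
    4·sum-total : 4 * sumFin (n G) total ≡ sumFin (n G) (λ v → 4 * charge total v)
    4·sum-total = trans (cong (4 *_) (sym (sumFin-charge total))) (sym (sumFin-*ˡ {n G} 4 (charge total)))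

    3·sum-budget : sumFin (n G) (λ v → 3 * budget v) ≡ 3 * (3 * n G + 2 * supportCount G)
    3·sum-budget = trans (sumFin-*ˡ {n G} 3 budget) (cong (3 *_) sumFin-budget)

  total-≤ : 4 * sumFin (n G) total ≤ 3 * (3 * n G + 2 * supportCount G)
  total-≤ = subst₂ _≤_ (sym 4·sum-total) 3·sum-budget (sumFin-mono charge-≤-budget)

  total-< : ∀ {v} → isLeaf v ≡ false → leafDegree v ≢ 1 → 4 * sumFin (n G) total < 3 * (3 * n G + 2 * supportCount G)
  total-< {v} nonleaf ℓ≢1 =
    subst₂ _<_ (sym 4·sum-total) 3·sum-budget (sumFin-mono-< charge-≤-budget v (charge-<-budget nonleaf ℓ≢1))

  sum-total : sumFin (n G) total ≡ sumFin 3 (λ i → weight G (f i))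
  sum-total = sumFin-comm (λ v i → f i v)

module LowerBound (G : Graph) (conn : Connected G) (3≤n : 3 ≤ n G) where
  open Leaves G
  open Connectivity conn
  open Charge G

  leaf-pair : ∀ {h} → IsTR2DF G h → ∀ {u v} → isLeaf u ≡ true → E G u v → 2 ≤ h v + h u
  leaf-pair {h} (_ , dominated , supported) {u} {v} leaf uv with h u in hu
  ... | zero with dominated u hu
  ...   | inj₁ (w , uw , hw≡2) rewrite leaf-neighbour-unique leaf uw uv | hw≡2 = ≤-refl
  ...   | inj₂ (a , b , a≢b , ua , ub , _) = ⊥-elim (a≢b (trans (leaf-neighbour-unique leaf ua uv) (sym (leaf-neighbour-unique leaf ub uv))))
  leaf-pair {h} (_ , dominated , supported) {u} {v} leaf uv | suc j
    with w , uw , hw≢0 ← supported u (λ hu≡0 → 1+n≢0 (trans (sym hu) hu≡0))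
    with h v in hv
  ... | zero  = ⊥-elim (hw≢0 (trans (cong h (leaf-neighbour-unique leaf uw uv)) hv))
  ... | suc i = s≤s (≤-trans (s≤s z≤n) (m≤n+m (suc j) i))

  module _ (one-leaf : NonleavesHaveOneLeaf) {h : V → ℕ} (h-tr2df : IsTR2DF G h) where

    hub-budget≤charge : ∀ {v u} → isLeaf v ≡ false → adjLeaf v u ≡ true → budget v ≤ 4 * charge h v
    hub-budget≤charge {v} {u} nonleaf vu = begin
      budget v                                   ≡⟨ budget-support nonleaf (≤-reflexive (sym ℓ≡1)) ⟩
      (3 + 3 * leafDegree v) + 2                 ≡⟨ cong (λ k → (3 + 3 * k) + 2) ℓ≡1 ⟩
      4 * 2                                      ≤⟨ *-monoʳ-≤ 4 (leaf-pair h-tr2df (proj₂ (adjLeaf⇒ vu)) (E-sym (proj₁ (adjLeaf⇒ vu)))) ⟩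
      4 * (h v + h u)                            ≡⟨ cong (λ b → 4 * ((if b then 0 else h v) + h u)) nonleaf ⟨
      4 * ((if isLeaf v then 0 else h v) + h u)  ≡⟨ cong (4 *_) (charge-one-leaf h ℓ≡1 vu) ⟨
      4 * charge h v                             ∎
      where
      open ≤-Reasoning
      ℓ≡1 : leafDegree v ≡ 1
      ℓ≡1 = one-leaf v nonleaf

    budget≤charge : ∀ v → budget v ≤ 4 * charge h v
    budget≤charge v with leaf-or-not v
    ... | inj₁ leaf    = subst (_≤ 4 * charge h v) (sym (budget-leaf leaf (leaf-leafDegree 3≤n leaf))) z≤n
    ... | inj₂ nonleaf = let _ , vu = count-witness (adjLeaf v) (≤-reflexive (sym (one-leaf v nonleaf)))
                         in hub-budget≤charge nonleaf vu

    lower-bound : 3 * n G + 2 * supportCount G ≤ 4 * weight G h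
    lower-bound = begin
      3 * n G + 2 * supportCount G            ≡⟨ sumFin-budget ⟨
      sumFin (n G) budget                     ≤⟨ sumFin-mono budget≤charge ⟩
      sumFin (n G) (λ v → 4 * charge h v)     ≡⟨ sumFin-*ˡ {n G} 4 (charge h) ⟩
      4 * sumFin (n G) (charge h)             ≡⟨ cong (4 *_) (sumFin-charge h) ⟩
      4 * weight G h                          ∎
      where open ≤-Reasoning

coronaAdj-hub-pendant : ∀ H a b → coronaAdj H (inj₁ a) (inj₂ b) ≡ does (a ≟ b)
coronaAdj-hub-pendant H a b with a ≟ b
... | yes _ = refl
... | no  _ = refl

coronaAdj-pendant-hub : ∀ H a b → coronaAdj H (inj₂ a) (inj₁ b) ≡ does (a ≟ b)
coronaAdj-pendant-hub H a b with a ≟ b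
... | yes _ = refl
... | no  _ = refl

module ToCorona (G : Graph) (conn : Connected G) (acyclic : Acyclic G) (3≤n : 3 ≤ n G) where
  open Leaves G
  open Connectivity conn

  module _ (one-leaf : NonleavesHaveOneLeaf) where

    open Enumeration (enumerate (λ x → not (isLeaf x)))

    hub-nonleaf : ∀ a → isLeaf (element a) ≡ false
    hub-nonleaf a = not-injective (element-p a)

    H : Graph
    H = record
      { n      = size
      ; adj    = λ a b → adj G (element a) (element b)
      ; sym    = λ a b → Graph.sym G (element a) (element b)
      ; irrefl = λ a → irrefl G (element a)
      }

    hub-walk : ∀ {x y} → Walk G x y → .(nx : not (isLeaf x) ≡ true) → .(ny : not (isLeaf y) ≡ true) →
               Walk H (position x nx) (position y ny)
    hub-walk here nx ny = here
    hub-walk {x} {y} (step {v = z} xz rest) nx ny with leaf-or-not z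
    ... | inj₂ nonleaf-z = step (subst₂ (E G) (sym (element∘position x nx)) (sym (element∘position z _)) xz)
                                (hub-walk rest (cong not nonleaf-z) ny)
    ... | inj₁ leaf-z = bounce rest
      where
      -- a walk that enters a leaf must come straight back
      bounce : Walk G z y → Walk H (position x nx) (position y ny)
      bounce here = ⊥-elim-irr (true≢false (trans (sym ny) (cong not leaf-z)))
      bounce (step zw rest′) with leaf-neighbour-unique leaf-z zw (E-sym xz)
      ... | refl = hub-walk rest′ nx ny

    H-connected : Connected H
    H-connected a b = subst₂ (Walk H) (position∘element a) (position∘element b)
                        (hub-walk (conn (element a) (element b)) (element-p a) (element-p b))

    H-acyclic : Acyclic H
    H-acyclic []       cycle = acyclic [] cycle
    H-acyclic (a ∷ as) (2≤length , unique , linked) = acyclic (element a ∷ map element as)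
      ( subst (2 ≤_) (sym (length-map element as)) 2≤length
      , Unique.map⁺ element-injective unique
      , subst (λ l → Linked (E G) (element a ∷ l)) (map-++ element as [ a ]) (Linked.map⁺ linked)
      )

    pendant : Fin size → V
    pendant a = proj₁ (count-witness (adjLeaf (element a)) (≤-reflexive (sym (one-leaf (element a) (hub-nonleaf a)))))

    hub-pendant : ∀ a → adjLeaf (element a) (pendant a) ≡ true
    hub-pendant a = proj₂ (count-witness (adjLeaf (element a)) (≤-reflexive (sym (one-leaf (element a) (hub-nonleaf a)))))

    support : ∀ {x} → isLeaf x ≡ true → V
    support leaf = proj₁ (leaf-neighbour leaf)

    leaf-support : ∀ {x} (leaf : isLeaf x ≡ true) → E G x (support leaf)
    leaf-support leaf = proj₂ (leaf-neighbour leaf)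

    to : V → Fin size ⊎ Fin size
    to x with leaf-or-not x
    ... | inj₁ leaf    = inj₂ (position (support leaf) (cong not (leaf-neighbour-nonleaf 3≤n leaf (leaf-support leaf))))
    ... | inj₂ nonleaf = inj₁ (position x (cong not nonleaf))

    from : Fin size ⊎ Fin size → V
    from (inj₁ a) = element a
    from (inj₂ a) = pendant a

    from∘to : ∀ x → from (to x) ≡ x
    from∘to x with leaf-or-not x
    ... | inj₂ nonleaf = element∘position x _
    ... | inj₁ leaf    = count≡1⇒unique (adjLeaf s) (one-leaf s s-nonleaf) s-pendant (adjLeaf-intro (E-sym (leaf-support leaf)) leaf)
      where
      s : V
      s = support leaf
      s-nonleaf : isLeaf s ≡ false
      s-nonleaf = leaf-neighbour-nonleaf 3≤n leaf (leaf-support leaf)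
      a : Fin size
      a = position s (cong not s-nonleaf)
      s-pendant : adjLeaf s (pendant a) ≡ true
      s-pendant = subst (λ v → adjLeaf v (pendant a) ≡ true) (element∘position s _) (hub-pendant a)

    pendant-leaf : ∀ a → isLeaf (pendant a) ≡ true
    pendant-leaf a = proj₂ (adjLeaf⇒ (hub-pendant a))

    to∘from : ∀ y → to (from y) ≡ y
    to∘from (inj₁ a) with leaf-or-not (element a)
    ... | inj₂ _    = cong inj₁ (position∘element a)
    ... | inj₁ leaf with () ← trans (sym leaf) (hub-nonleaf a)
    to∘from (inj₂ a) with leaf-or-not (pendant a)
    ... | inj₁ leaf    = cong inj₂ (trans (position-cong support≡hub) (position∘element a))
      where
      support≡hub : support leaf ≡ element a
      support≡hub = leaf-neighbour-unique leaf (leaf-support leaf) (E-sym (proj₁ (adjLeaf⇒ (hub-pendant a))))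
    ... | inj₂ nonleaf with () ← trans (sym (pendant-leaf a)) nonleaf

    hub-leaf-adj : ∀ {x y} → .(nx : not (isLeaf x) ≡ true) → (ly : isLeaf y ≡ true) → .(ns : not (isLeaf (support ly)) ≡ true) →
                   adj G x y ≡ does (position x nx ≟ position (support ly) ns)
    hub-leaf-adj {x} {y} nx ly ns with adj G x y in xy | position x nx ≟ position (support ly) ns
    ... | true  | yes _   = refl
    ... | false | no  _   = refl
    ... | true  | no  a≢b = ⊥-elim (a≢b (position-cong (leaf-neighbour-unique ly (E-sym xy) (leaf-support ly))))
    ... | false | yes a≡b = ⊥-elim (true≢false (trans (sym (E-sym (leaf-support ly))) (trans (cong₂ (adj G) (sym x≡s) refl) xy)))
      where
      x≡s : x ≡ support ly
      x≡s = trans (sym (element∘position x nx)) (trans (cong element a≡b) (element∘position (support ly) ns))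

    adj-to : ∀ x y → adj G x y ≡ coronaAdj H (to x) (to y)
    adj-to x y with leaf-or-not x | leaf-or-not y
    ... | inj₂ nx | inj₂ ny = sym (cong₂ (adj G) (element∘position x _) (element∘position y _))
    ... | inj₂ nx | inj₁ ly = trans (hub-leaf-adj _ ly _) (sym (coronaAdj-hub-pendant H _ _))
    ... | inj₁ lx | inj₂ ny = trans (Graph.sym G x y) (trans (hub-leaf-adj _ lx _)
                                (trans (does-⇔ (mk⇔ sym sym) (position y (cong not ny) ≟ position (support lx) _) (position (support lx) _ ≟ position y (cong not ny)))
                                       (sym (coronaAdj-pendant-hub H _ _))))
    ... | inj₁ lx | inj₁ ly with adj G x y in xy
    ...   | false = refl
    ...   | true  with () ← trans (sym ly) (leaf-neighbour-nonleaf 3≤n lx xy)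

    isCoronaOfTree : IsCoronaOfTree G
    isCoronaOfTree = H , (H-connected , H-acyclic) , mk↔ₛ′ to from to∘from from∘to , adj-to

module FromCorona (G : Graph) (3≤n : 3 ≤ n G) (H : Graph) (H-connected : Connected H)
                  (φ : Fin (n G) ↔ (Fin (n H) ⊎ Fin (n H)))
                  (adj≡ : ∀ x y → adj G x y ≡ coronaAdj H (Inverse.to φ x) (Inverse.to φ y)) where
  open Leaves G
  open Inverse φ using (to; from; strictlyInverseˡ; strictlyInverseʳ)

  2≤size : 2 ≤ n H
  2≤size = halve (≤-trans 3≤n (injective⇒≤ (Injection.injective (↔⇒↣ (↔-sym +↔⊎ ↔-∘ φ)))))
    where
    halve : ∀ {m} → 3 ≤ m + m → 2 ≤ m
    halve {suc (suc _)} _ = s≤s (s≤s z≤n)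
    halve {suc zero} (s≤s (s≤s ()))

  vertex : ∀ {x p} → to x ≡ p → x ≡ from p
  vertex {x} tx = trans (sym (strictlyInverseʳ x)) (cong from tx)

  adj-from : ∀ p q → adj G (from p) (from q) ≡ coronaAdj H p q
  adj-from p q = trans (adj≡ (from p) (from q)) (cong₂ (coronaAdj H) (strictlyInverseˡ p) (strictlyInverseˡ q))

  neighbour-from : ∀ p {w} → E G (from p) w → coronaAdj H p (to w) ≡ true
  neighbour-from p {w} pw = trans (cong (λ q → coronaAdj H q (to w)) (sym (strictlyInverseˡ p))) (trans (sym (adj≡ (from p) w)) pw)

  pendant-edge : ∀ a → E G (from (inj₁ a)) (from (inj₂ a))
  pendant-edge a = trans (adj-from (inj₁ a) (inj₂ a)) (trans (coronaAdj-hub-pendant H a a) (dec-true (a ≟ a) refl))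

  pendant-isLeaf : ∀ a → isLeaf (from (inj₂ a)) ≡ true
  pendant-isLeaf a = unique-neighbour⇒leaf (E-sym (pendant-edge a)) only-hub
    where
    only-hub : ∀ w → E G (from (inj₂ a)) w → w ≡ from (inj₁ a)
    only-hub w aw with to w in tw | neighbour-from (inj₂ a) aw
    ... | inj₁ b | a~b = trans (vertex tw) (cong (from ∘ inj₁) (sym (does-true⇒ (a ≟ b) (trans (sym (coronaAdj-pendant-hub H a b)) a~b))))
    ... | inj₂ b | ()

  hub-degree : ∀ a → 2 ≤ degree G (from (inj₁ a))
  hub-degree a =
    let b , ab = Leaves.Connectivity.neighbour-exists H H-connected 2≤size a
    in count-≥2 (adj G (from (inj₁ a))) (pendant≢hub b) (pendant-edge a) (trans (adj-from (inj₁ a) (inj₁ b)) ab)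
    where
    pendant≢hub : ∀ b → from (inj₂ a) ≢ from (inj₁ b)
    pendant≢hub b eq with () ← trans (sym (strictlyInverseˡ (inj₂ a))) (trans (cong to eq) (strictlyInverseˡ (inj₁ b)))

  hub-nonleaf : ∀ a → isLeaf (from (inj₁ a)) ≡ false
  hub-nonleaf a with isLeaf (from (inj₁ a)) in leaf
  ... | false = refl
  ... | true  = ⊥-elim (1+n≰n (subst (2 ≤_) (isLeaf⇒degree≡1 leaf) (hub-degree a)))

  hub-leafDegree : ∀ a → leafDegree (from (inj₁ a)) ≡ 1
  hub-leafDegree a = count≡1 (adjLeaf (from (inj₁ a))) (adjLeaf-intro (pendant-edge a) (pendant-isLeaf a)) only-pendant
    where
    only-pendant : ∀ u → adjLeaf (from (inj₁ a)) u ≡ true → u ≡ from (inj₂ a)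
    only-pendant u au with to u in tu | neighbour-from (inj₁ a) (proj₁ (adjLeaf⇒ au))
    ... | inj₁ b | _   with () ← trans (sym (proj₂ (adjLeaf⇒ au))) (trans (cong isLeaf (vertex tu)) (hub-nonleaf b))
    ... | inj₂ b | a~b = trans (vertex tu) (cong (from ∘ inj₂) (sym (does-true⇒ (a ≟ b) (trans (sym (coronaAdj-hub-pendant H a b)) a~b))))

  nonleavesHaveOneLeaf : NonleavesHaveOneLeaf
  nonleavesHaveOneLeaf v nonleaf with to v in tv
  ... | inj₁ a = trans (cong leafDegree (vertex tv)) (hub-leafDegree a)
  ... | inj₂ a with () ← trans (sym nonleaf) (trans (cong isLeaf (vertex tv)) (pendant-isLeaf a))

IsCoronaOfTree⇒NonleavesHaveOneLeaf : ∀ {G} → 3 ≤ n G → IsCoronaOfTree G → Leaves.NonleavesHaveOneLeaf G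
IsCoronaOfTree⇒NonleavesHaveOneLeaf {G} 3≤n (H , (H-connected , _) , φ , adj≡) =
  FromCorona.nonleavesHaveOneLeaf G 3≤n H H-connected φ adj≡

module Bounds (G : Graph) (conn : Connected G) (acyclic : Acyclic G) (4≤n : 4 ≤ n G) {k : ℕ} (γ : IsγtR2 G k) where
  open Leaves G
  open ColouredTR2DFs G conn acyclic (≤-trans (n≤1+n 3) 4≤n) using (f; f-isTR2DF)
  open Discharging G conn acyclic 4≤n

  12k≤4·total : 3 * (4 * k) ≤ 4 * sumFin (n G) total
  12k≤4·total = begin
    3 * (4 * k)                             ≡⟨ trans (sym (*-assoc 3 4 k)) (*-assoc 4 3 k) ⟩
    4 * sumFin 3 (λ _ → k)                  ≤⟨ *-monoʳ-≤ 4 (sumFin-mono (λ i → proj₂ γ (f i) (f-isTR2DF i))) ⟩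
    4 * sumFin 3 (λ i → weight G (f i))     ≡⟨ cong (4 *_) sum-total ⟨
    4 * sumFin (n G) total                  ∎
    where open ≤-Reasoning

  upper-bound : 4 * k ≤ 3 * n G + 2 * supportCount G
  upper-bound = *-cancelˡ-≤ 3 (≤-trans 12k≤4·total total-≤)

  tight⇒nonleavesHaveOneLeaf : 4 * k ≡ 3 * n G + 2 * supportCount G → NonleavesHaveOneLeaf
  tight⇒nonleavesHaveOneLeaf tight v nonleaf with leafDegree v ≟ℕ 1
  ... | yes ℓ≡1 = ℓ≡1
  ... | no  ℓ≢1 = ⊥-elim (≤⇒≯ 12k≤4·total (subst (4 * sumFin (n G) total <_) (cong (3 *_) (sym tight)) (total-< nonleaf ℓ≢1)))

  nonleavesHaveOneLeaf⇒tight : NonleavesHaveOneLeaf → 4 * k ≡ 3 * n G + 2 * supportCount G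
  nonleavesHaveOneLeaf⇒tight one-leaf =
    let h , h-tr2df , weight≡k = proj₁ γ in
    ≤-antisym upper-bound (subst (λ w → 3 * n G + 2 * supportCount G ≤ 4 * w) weight≡k
                                 (LowerBound.lower-bound G conn (≤-trans (n≤1+n 3) 4≤n) one-leaf h-tr2df))

mainTheorem18 : (T : Graph) → IsTree T → 4 ≤ n T → (k : ℕ) → IsγtR2 T k →
    (4 * k ≤ 3 * n T + 2 * supportCount T) ×
    ((4 * k ≡ 3 * n T + 2 * supportCount T) ⇔ IsCoronaOfTree T)
mainTheorem18 T (conn , acyclic) 4≤n k γ =
  upper-bound ,
  mk⇔ (ToCorona.isCoronaOfTree T conn acyclic 3≤n ∘ tight⇒nonleavesHaveOneLeaf)
      (nonleavesHaveOneLeaf⇒tight ∘ IsCoronaOfTree⇒NonleavesHaveOneLeaf {T} 3≤n)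
  where
  open Bounds T conn acyclic 4≤n γ
  3≤n : 3 ≤ n T
  3≤n = ≤-trans (n≤1+n 3) 4≤n
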